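{- For every integer $n \ge 20$, let $\mathcal{L}(n)$ be the maximum, over all states $T$ reachable from ${}_0(n)$ by a finite sequence of Bergman Game moves, of $-m(T)$, where $m(T)=\min\{i : T_i > 0\}$ is the index of the leftmost chip of $T$. Then \[ 2n - 3\log_\varphi n - 8 \;\leq\; \mathcal{L}(n) \;\leq\; 2n + \log_\varphi n + 2, \] where $\varphi=\frac{1+\sqrt5}{2}$.
   Context: The Bergman Game: a state is a function $a:\mathbb{Z}\to\mathbb{Z}_{\geq 0}$ with finite support; $a_i$ is the number of chips (summands) at index $i$. A combine at index $i$ is available if $a_i \geq 1$ and $a_{i+1} \geq 1$; it decreases $a_i$ and $a_{i+1}$ by $1$ each and increases $a_{i+2}$ by $1$. A split at index $i$ is available if $a_i \geq 2$; it decreases $a_i$ by $2$ and increases each of $a_{i+1}$ and $a_{i-2}$ by $1$. The state ${}_0(n)$ has $n$ chips at index $0$ and none elsewhere. -}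

module Defs where

open import Data.Nat as ℕ using (ℕ; zero; suc; _∸_)
open import Data.Integer as ℤ using (ℤ; +_; -[1+_]; _≟_)
open import Data.Bool using (if_then_else_)
open import Data.Product using (_×_)
open import Data.Unit using (⊤)
open import Relation.Nullary.Decidable using (⌊_⌋)
open import Relation.Binary.PropositionalEquality using (_≡_)
open import Relation.Binary.Construct.Closure.ReflexiveTransitive using (Star)

-- A state: a_i = number of chips at index i.  (Finite support is automatic
-- for every state reachable from the initial one.)
State : Set
State = ℤ → ℕ

dec1 : ℤ → State → State
dec1 i a j = if ⌊ j ≟ i ⌋ then a j ∸ 1 else a j

inc1 : ℤ → State → State
inc1 i a j = if ⌊ j ≟ i ⌋ then suc (a j) else a j

combineAt : State → ℤ → State
combineAt a i = inc1 (i ℤ.+ + 2) (dec1 (i ℤ.+ + 1) (dec1 i a))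

splitAt : State → ℤ → State
splitAt a i = inc1 (i ℤ.- + 2) (inc1 (i ℤ.+ + 1) (dec1 i (dec1 i a)))

data Move : State → State → Set where
  combine : ∀ {a} i → 1 ℕ.≤ a i → 1 ℕ.≤ a (i ℤ.+ + 1) → Move a (combineAt a i)
  split   : ∀ {a} i → 2 ℕ.≤ a i → Move a (splitAt a i)

Reachable : State → State → Set
Reachable = Star Move

start : ℕ → State
start n j = if ⌊ j ≟ + 0 ⌋ then n else 0

IsLeftmost : State → ℤ → Set
IsLeftmost T i = (0 ℕ.< T i) × (∀ j → j ℤ.< i → T j ≡ 0)

-- Fibonacci and Lucas numbers; φ^k = (lucas k + fib k · √5) / 2
fib : ℕ → ℕ
fib 0 = 0
fib 1 = 1
fib (suc (suc k)) = fib (suc k) ℕ.+ fib k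

lucas : ℕ → ℕ
lucas 0 = 2
lucas 1 = 1
lucas (suc (suc k)) = lucas (suc k) ℕ.+ lucas k

-- φ^k ≤ m  (k, m naturals), decided exactly in ℤ[√5]:
-- L_k + F_k √5 ≤ 2m  ⇔  L_k ≤ 2m  ∧  5 F_k² ≤ (2m − L_k)²
PhiPow≤ : ℕ → ℕ → Set
PhiPow≤ k m = (lucas k ℕ.≤ 2 ℕ.* m)
            × (5 ℕ.* (fib k ℕ.* fib k) ℕ.≤ (2 ℕ.* m ∸ lucas k) ℕ.* (2 ℕ.* m ∸ lucas k))

-- x ≤ c · log_φ m   (x : ℤ, c m : ℕ, m ≥ 1), i.e. φ^x ≤ m^c.
-- For x ≤ 0 this holds automatically since m^c ≥ 1.
≤LogPhi : ℤ → ℕ → ℕ → Set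
≤LogPhi (+ k) c m = PhiPow≤ k (m ℕ.^ c)
≤LogPhi -[1+ k ] c m = ⊤

module Submission where

-- Extend the Fibonacci numbers to all of ℤ. As F_x + F_{x+1} = F_{x+2} and 2 F_x = F_{x+1} + F_{x-2},
-- every move preserves Σ_p F_{J+p}, which starts as n F_J, for each J (together these record that the
-- chips have value n both in base φ and in base ψ = -1/φ); no move increases the number of chips.
--
-- Upper bound. Take J = -K with K above all chips and record each chip p by its depth K - p; then
-- Σ_p F_{p-K} = ±n F_K. Combines and splits of depths are again Bergman moves and keep this sum;
-- running them until none applies shows that a chip at depth x among c chips forces
-- |Σ| ≥ F_{x+2-2c}. Hence a chip at -d gives F_K F_{d-2n} ≤ n F_K.
--
-- Lower bound. Split repeated chips until all are distinct; this stops because Σ p drops by one per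
-- split and, by the upper bound, is bounded below. Taking J large bounds the top chip t by
-- F_{t+1} ≤ n, so the alternating sum of the n distinct depths is at most n F_K ≤ n². As the leftmost
-- chip contributes F_R, the other depths sum to within n² of their maximum, which forces them to
-- read 1 0 1 0 … down to the level log_φ(n²); so the n chips span about 2n positions.

open import Defs
open import Relation.Binary.Definitions using (DecidableEquality)

module Fibonacci where

  open import Data.Nat.Base
  open import Data.Nat.Properties
  open import Data.Product using (_,_)
  open import Function using (_∘_)
  open import Relation.Binary.PropositionalEquality
  open import Data.Nat.Tactic.RingSolver using (solve-∀)
  open ≤-Reasoning

  fib-+ : ∀ m n → fib (suc (m + n)) ≡ fib (suc m) * fib (suc n) + fib m * fib n
  fib-+ zero    n = sym (trans (+-identityʳ _) (+-identityʳ _))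
  fib-+ (suc m) n = begin-equality
    fib (suc (suc m + n))                                 ≡⟨ cong (fib ∘ suc) (+-suc m n) ⟨
    fib (suc (m + suc n))                                 ≡⟨ fib-+ m (suc n) ⟩
    fib (suc m) * (fib (suc n) + fib n) + fib m * fib (suc n)
      ≡⟨ regroup (fib (suc m)) (fib m) (fib (suc n)) (fib n) ⟩
    (fib (suc m) + fib m) * fib (suc n) + fib (suc m) * fib n ∎
    where
    regroup : ∀ a b c d → a * (c + d) + b * c ≡ (a + b) * c + a * d
    regroup = solve-∀

  fib[n]≤fib[1+n] : ∀ k → fib k ≤ fib (suc k)
  fib[n]≤fib[1+n] zero          = z≤n
  fib[n]≤fib[1+n] (suc zero)    = ≤-refl
  fib[n]≤fib[1+n] (suc (suc k)) = m≤m+n _ _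

  fib-mono : ∀ {k l} → k ≤ l → fib k ≤ fib l
  fib-mono k≤l = go (≤⇒≤′ k≤l)
    where
    go : ∀ {k l} → k ≤′ l → fib k ≤ fib l
    go ≤′-refl       = ≤-refl
    go (≤′-step {l} k≤l) = ≤-trans (go k≤l) (fib[n]≤fib[1+n] l)

  1≤fib[1+n] : ∀ k → 1 ≤ fib (suc k)
  1≤fib[1+n] k = fib-mono {1} {suc k} (s≤s z≤n)

  n≤fib[1+n] : ∀ n → n ≤ fib (suc n)
  n≤fib[1+n] zero          = z≤n
  n≤fib[1+n] (suc zero)    = ≤-refl
  n≤fib[1+n] (suc (suc n)) = begin
    2 + n                     ≡⟨ +-comm 1 (suc n) ⟩
    suc n + 1                 ≤⟨ +-mono-≤ (n≤fib[1+n] (suc n)) (1≤fib[1+n] n) ⟩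
    fib (2 + n) + fib (1 + n) ∎

  fib*fib≤fib : ∀ m n → fib (suc m) * fib (suc n) ≤ fib (suc (m + n))
  fib*fib≤fib m n = begin
    fib (suc m) * fib (suc n)                 ≤⟨ m≤m+n _ _ ⟩
    fib (suc m) * fib (suc n) + fib m * fib n ≡⟨ fib-+ m n ⟨
    fib (suc (m + n))                         ∎

  fib≤fib*fib : ∀ m n → fib (m + n) ≤ fib (suc m) * fib (suc n)
  fib≤fib*fib m zero = begin
    fib (m + 0)         ≡⟨ cong fib (+-identityʳ m) ⟩
    fib m               ≤⟨ fib[n]≤fib[1+n] m ⟩
    fib (suc m)         ≡⟨ *-identityʳ _ ⟨
    fib (suc m) * 1     ∎
  fib≤fib*fib m (suc n) = begin
    fib (m + suc n)                             ≡⟨ cong fib (+-suc m n) ⟩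
    fib (suc (m + n))                           ≡⟨ fib-+ m n ⟩
    fib (suc m) * fib (suc n) + fib m * fib n   ≤⟨ +-monoʳ-≤ _ (*-monoˡ-≤ (fib n) (fib[n]≤fib[1+n] m)) ⟩
    fib (suc m) * fib (suc n) + fib (suc m) * fib n ≡⟨ *-distribˡ-+ (fib (suc m)) _ _ ⟨
    fib (suc m) * fib (suc (suc n))             ∎

  2*fib[2+k]≡3*fib[k]+lucas[k] : ∀ k → 2 * fib (2 + k) ≡ 3 * fib k + lucas k
  2*fib[2+k]≡3*fib[k]+lucas[k] zero          = refl
  2*fib[2+k]≡3*fib[k]+lucas[k] (suc zero)    = refl
  2*fib[2+k]≡3*fib[k]+lucas[k] (suc (suc k)) = begin-equality
    2 * (fib (3 + k) + fib (2 + k))                       ≡⟨ *-distribˡ-+ 2 (fib (3 + k)) _ ⟩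
    2 * fib (3 + k) + 2 * fib (2 + k)                     ≡⟨ cong₂ _+_ (2*fib[2+k]≡3*fib[k]+lucas[k] (suc k))
                                                                       (2*fib[2+k]≡3*fib[k]+lucas[k] k) ⟩
    (3 * fib (1 + k) + lucas (1 + k)) + (3 * fib k + lucas k)
      ≡⟨ regroup (fib (1 + k)) (fib k) (lucas (1 + k)) (lucas k) ⟩
    3 * (fib (1 + k) + fib k) + (lucas (1 + k) + lucas k) ∎
    where
    regroup : ∀ a b c d → (3 * a + c) + (3 * b + d) ≡ 3 * (a + b) + (c + d)
    regroup = solve-∀

  -- φᵏ = (Lₖ + √5 Fₖ)/2 ≤ (Lₖ + 3 Fₖ)/2 = Fₖ₊₂
  phiPow≤-fib : ∀ k m → fib (2 + k) ≤ m → PhiPow≤ k m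
  phiPow≤-fib k m F≤m = L≤2m , 5F²≤d²
    where
    3F+L≤2m : 3 * fib k + lucas k ≤ 2 * m
    3F+L≤2m = subst (_≤ 2 * m) (2*fib[2+k]≡3*fib[k]+lucas[k] k) (*-monoʳ-≤ 2 F≤m)
    L≤2m : lucas k ≤ 2 * m
    L≤2m = ≤-trans (m≤n+m _ _) 3F+L≤2m
    3F≤d : 3 * fib k ≤ 2 * m ∸ lucas k
    3F≤d = subst (_≤ 2 * m ∸ lucas k) (m+n∸n≡m (3 * fib k) (lucas k)) (∸-monoˡ-≤ (lucas k) 3F+L≤2m)
    5F²≤d² : 5 * (fib k * fib k) ≤ (2 * m ∸ lucas k) * (2 * m ∸ lucas k)
    5F²≤d² = begin
      5 * (fib k * fib k)                         ≤⟨ m≤m+n _ (4 * (fib k * fib k)) ⟩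
      5 * (fib k * fib k) + 4 * (fib k * fib k)   ≡⟨ nine-squares (fib k) ⟩
      (3 * fib k) * (3 * fib k)                   ≤⟨ *-mono-≤ 3F≤d 3F≤d ⟩
      (2 * m ∸ lucas k) * (2 * m ∸ lucas k)       ∎
      where
      nine-squares : ∀ f → 5 * (f * f) + 4 * (f * f) ≡ (3 * f) * (3 * f)
      nine-squares = solve-∀

module IntegerFibonacci where

  open Fibonacci using (phiPow≤-fib)
  open import Data.Nat.Base as ℕ using (ℕ; zero; suc; _^_)
  open import Data.Unit using (tt)
  import Data.Nat.Properties as ℕₚ
  open import Data.Integer.Base using (ℤ; +_; -[1+_]; -_; _+_; _-_; _*_; ∣_∣; 1ℤ)
  open import Data.Integer.Properties using (∣-i∣≡∣i∣; ∣i*j∣≡∣i∣*∣j∣; +-comm)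
  open import Relation.Binary.PropositionalEquality
  open import Data.Integer.Tactic.RingSolver using (solve-∀)
  open ≡-Reasoning

  alt : ℕ → ℤ
  alt zero    = 1ℤ
  alt (suc k) = - alt k

  alt*alt : ∀ k → alt k * alt k ≡ 1ℤ
  alt*alt zero    = refl
  alt*alt (suc k) = trans (neg-squares (alt k)) (alt*alt k)
    where
    neg-squares : ∀ a → (- a) * (- a) ≡ a * a
    neg-squares = solve-∀

  ∣alt∣ : ∀ k → ∣ alt k ∣ ≡ 1
  ∣alt∣ zero    = refl
  ∣alt∣ (suc k) = trans (∣-i∣≡∣i∣ (alt k)) (∣alt∣ k)

  fibℤ : ℤ → ℤ
  fibℤ (+ k)    = + fib k
  fibℤ -[1+ k ] = alt k * + fib (suc k)

  negFib : ℕ → ℤ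
  negFib r = fibℤ (- + r)

  ∣negFib∣ : ∀ r → ∣ negFib r ∣ ≡ fib r
  ∣negFib∣ zero    = refl
  ∣negFib∣ (suc k) = begin
    ∣ alt k * + fib (suc k) ∣       ≡⟨ ∣i*j∣≡∣i∣*∣j∣ (alt k) _ ⟩
    ∣ alt k ∣ ℕ.* fib (suc k)       ≡⟨ cong (ℕ._* fib (suc k)) (∣alt∣ k) ⟩
    1 ℕ.* fib (suc k)               ≡⟨ ℕₚ.*-identityˡ _ ⟩
    fib (suc k)                     ∎

  negFib-rec : ∀ q → negFib q ≡ negFib (1 ℕ.+ q) + negFib (2 ℕ.+ q)
  negFib-rec zero    = refl
  negFib-rec (suc k) = cancel (alt k) (+ fib (suc k)) (+ fib (2 ℕ.+ k))
    where
    cancel : ∀ a f₁ f₂ → a * f₁ ≡ (- a) * f₂ + (- - a) * (f₂ + f₁)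
    cancel = solve-∀

  fibℤ-rec : ∀ x → fibℤ (x + + 2) ≡ fibℤ (x + + 1) + fibℤ x
  fibℤ-rec (+ k) rewrite ℕₚ.+-comm k 2 | ℕₚ.+-comm k 1 = refl
  fibℤ-rec -[1+ zero ]    = refl
  fibℤ-rec -[1+ 1 ]            = refl
  fibℤ-rec -[1+ suc (suc j) ]   = negFib-rec (suc j)

  fibℤ-rec-at : ∀ x {y z} → y ≡ x + + 1 → z ≡ x + + 2 → fibℤ z ≡ fibℤ y + fibℤ x
  fibℤ-rec-at x refl refl = fibℤ-rec x

  fibℤ-combine : ∀ J i → fibℤ (J + i) + fibℤ (J + (i + + 1)) ≡ fibℤ (J + (i + + 2))
  fibℤ-combine J i = begin
    fibℤ (J + i) + fibℤ (J + (i + + 1))   ≡⟨ +-comm (fibℤ (J + i)) _ ⟩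
    fibℤ (J + (i + + 1)) + fibℤ (J + i)   ≡⟨ fibℤ-rec-at (J + i) (shift J i (+ 1)) (shift J i (+ 2)) ⟨
    fibℤ (J + (i + + 2))                  ∎
    where
    shift : ∀ J i k → J + (i + k) ≡ J + i + k
    shift = solve-∀

  fibℤ-split : ∀ J i → fibℤ (J + i) + fibℤ (J + i) ≡ fibℤ (J + (i - + 2)) + fibℤ (J + (i + + 1))
  fibℤ-split J i = begin
    fibℤ x + fibℤ x                  ≡⟨ cong (_+_ (fibℤ x)) (fibℤ-rec-at a (e₁ J i) (e₂ J i)) ⟩
    fibℤ x + (fibℤ (x - + 1) + fibℤ a) ≡⟨ regroup (fibℤ x) (fibℤ (x - + 1)) (fibℤ a) ⟩
    fibℤ a + (fibℤ x + fibℤ (x - + 1)) ≡⟨ cong (_+_ (fibℤ a)) (fibℤ-rec-at (x - + 1) (e₃ J i) (e₄ J i)) ⟨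
    fibℤ a + fibℤ (J + (i + + 1))    ∎
    where
    x = J + i
    a = J + (i - + 2)
    e₁ : ∀ J i → J + i - + 1 ≡ J + (i - + 2) + + 1
    e₁ = solve-∀
    e₂ : ∀ J i → J + i ≡ J + (i - + 2) + + 2
    e₂ = solve-∀
    e₃ : ∀ J i → J + i ≡ J + i - + 1 + + 1
    e₃ = solve-∀
    e₄ : ∀ J i → J + (i + + 1) ≡ J + i - + 1 + + 2
    e₄ = solve-∀
    regroup : ∀ a b c → a + (b + c) ≡ c + (a + b)
    regroup = solve-∀

  negFib-split : ∀ q → negFib (1 ℕ.+ q) + negFib (1 ℕ.+ q) ≡ negFib q + negFib (3 ℕ.+ q)
  negFib-split q = begin
    negFib (1 ℕ.+ q) + negFib (1 ℕ.+ q)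
      ≡⟨ cong (_+_ (negFib (1 ℕ.+ q))) (negFib-rec (1 ℕ.+ q)) ⟩
    negFib (1 ℕ.+ q) + (negFib (2 ℕ.+ q) + negFib (3 ℕ.+ q))
      ≡⟨ regroup (negFib (1 ℕ.+ q)) _ _ ⟩
    (negFib (1 ℕ.+ q) + negFib (2 ℕ.+ q)) + negFib (3 ℕ.+ q)
      ≡⟨ cong (_+ negFib (3 ℕ.+ q)) (negFib-rec q) ⟨
    negFib q + negFib (3 ℕ.+ q) ∎
    where
    regroup : ∀ a b c → a + (b + c) ≡ (a + b) + c
    regroup = solve-∀

  ≤LogPhi-fib : ∀ z c m → (∀ k → z ≡ + k → fib (2 ℕ.+ k) ℕ.≤ m ^ c) → ≤LogPhi z c m
  ≤LogPhi-fib (+ k)    c m fib≤ = phiPow≤-fib k (m ^ c) (fib≤ k refl)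
  ≤LogPhi-fib -[1+ _ ] c m _    = tt

module Multiset {A : Set} (_≟_ : DecidableEquality A) where

  open import Data.Bool.Base using (if_then_else_)
  open import Data.Nat.Base using (ℕ; suc; _∸_; _<_; z≤n; s≤s)
  open import Data.Integer.Base as ℤ using (ℤ; 0ℤ; _+_)
  import Data.Integer.Properties as ℤₚ
  open import Data.List.Base using (List; []; _∷_)
  open import Data.List.Membership.Propositional using (_∈_)
  open import Data.List.Relation.Unary.Any using (here; there)
  open import Data.List.Relation.Binary.Permutation.Propositional as ↭
    using (_↭_; ↭-refl; ↭-prep; ↭-swap; ↭-trans)
  open import Data.Empty using (⊥-elim)
  open import Relation.Nullary using (yes; no)
  open import Relation.Nullary.Decidable using (⌊_⌋)
  open import Relation.Binary.PropositionalEquality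
  open import Data.Integer.Tactic.RingSolver using (solve-∀)
  open import Function using (_∘_)

  count : A → List A → ℕ
  count x []       = 0
  count x (y ∷ ys) = if ⌊ x ≟ y ⌋ then suc (count x ys) else count x ys

  remove : A → List A → List A
  remove x []       = []
  remove x (y ∷ ys) = if ⌊ x ≟ y ⌋ then ys else y ∷ remove x ys

  count-∷-≡ : ∀ {y x} xs → y ≡ x → count y (x ∷ xs) ≡ suc (count y xs)
  count-∷-≡ {y} {x} xs y≡x with y ≟ x
  ... | yes _   = refl
  ... | no y≢x  = ⊥-elim (y≢x y≡x)

  count-∷-≢ : ∀ {y x} xs → y ≢ x → count y (x ∷ xs) ≡ count y xs
  count-∷-≢ {y} {x} xs y≢x with y ≟ x
  ... | yes y≡x = ⊥-elim (y≢x y≡x)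
  ... | no _    = refl

  count-pos⇒∈ : ∀ {x} xs → 0 < count x xs → x ∈ xs
  count-pos⇒∈ {x} (y ∷ ys) 0<c with x ≟ y
  ... | yes refl = here refl
  ... | no _     = there (count-pos⇒∈ ys 0<c)

  ∈⇒count-pos : ∀ {x xs} → x ∈ xs → 0 < count x xs
  ∈⇒count-pos {x} {y ∷ ys} x∈ with x ≟ y | x∈
  ... | yes _   | _         = s≤s z≤n
  ... | no x≢y  | here x≡y  = ⊥-elim (x≢y x≡y)
  ... | no _    | there x∈′ = ∈⇒count-pos x∈′

  count-remove-≡ : ∀ x xs → count x (remove x xs) ≡ count x xs ∸ 1
  count-remove-≡ x []       = refl
  count-remove-≡ x (y ∷ ys) with x ≟ y
  ... | yes refl = refl
  ... | no x≢y   = trans (count-∷-≢ (remove x ys) x≢y) (count-remove-≡ x ys)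

  count-remove-≢ : ∀ {y x} xs → y ≢ x → count y (remove x xs) ≡ count y xs
  count-remove-≢         []       _   = refl
  count-remove-≢ {y} {x} (z ∷ zs) y≢x with x ≟ z
  ... | yes refl = sym (count-∷-≢ zs y≢x)
  ... | no _ with y ≟ z
  ...   | yes _ = cong suc (count-remove-≢ zs y≢x)
  ...   | no _  = count-remove-≢ zs y≢x

  ∈-remove⁺ : ∀ {y x xs} → y ≢ x → y ∈ xs → y ∈ remove x xs
  ∈-remove⁺ {xs = xs} y≢x y∈ = count-pos⇒∈ _ (subst (0 <_) (sym (count-remove-≢ xs y≢x)) (∈⇒count-pos y∈))

  ∈-remove⁻ : ∀ {y x} xs → y ∈ remove x xs → y ∈ xs
  ∈-remove⁻ {x = x} (z ∷ zs) y∈ with x ≟ z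
  ... | yes _ = there y∈
  ... | no _ with y∈
  ...   | here y≡z  = here y≡z
  ...   | there y∈′ = there (∈-remove⁻ zs y∈′)

  remove-↭ : ∀ {x xs} → x ∈ xs → xs ↭ x ∷ remove x xs
  remove-↭ {x} {y ∷ ys} x∈ with x ≟ y | x∈
  ... | yes refl | _         = ↭-refl
  ... | no x≢y   | here x≡y  = ⊥-elim (x≢y x≡y)
  ... | no _     | there x∈′ = ↭-trans (↭-prep y (remove-↭ x∈′)) (↭-swap y x ↭-refl)

  remove₂-↭ : ∀ {x y xs} → x ∈ xs → y ∈ remove x xs → xs ↭ x ∷ y ∷ remove y (remove x xs)
  remove₂-↭ x∈ y∈ = ↭-trans (remove-↭ x∈) (↭-prep _ (remove-↭ y∈))

  ∑ : (A → ℤ) → List A → ℤ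
  ∑ f []       = 0ℤ
  ∑ f (x ∷ xs) = f x + ∑ f xs

  ∑-↭ : ∀ f {xs ys} → xs ↭ ys → ∑ f xs ≡ ∑ f ys
  ∑-↭ f ↭.refl          = refl
  ∑-↭ f (↭.prep x p)    = cong (f x +_) (∑-↭ f p)
  ∑-↭ f (↭.swap x y p)  = trans (cong (λ s → f x + (f y + s)) (∑-↭ f p)) (exchange (f x) (f y) _)
    where
    exchange : ∀ a b s → a + (b + s) ≡ b + (a + s)
    exchange = solve-∀
  ∑-↭ f (↭.trans p q)   = trans (∑-↭ f p) (∑-↭ f q)

  ∑-nonneg : ∀ f xs → (∀ {x} → x ∈ xs → 0ℤ ℤ.≤ f x) → 0ℤ ℤ.≤ ∑ f xs
  ∑-nonneg f []       _   = ℤₚ.≤-refl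
  ∑-nonneg f (x ∷ xs) 0≤f = ℤₚ.+-mono-≤ (0≤f (here refl)) (∑-nonneg f xs (0≤f ∘ there))

  term≤∑ : ∀ f {x xs} → (∀ {y} → y ∈ xs → 0ℤ ℤ.≤ f y) → x ∈ xs → f x ℤ.≤ ∑ f xs
  term≤∑ f {x} {xs} 0≤f x∈ = begin
    f x                        ≡⟨ ℤₚ.+-identityʳ (f x) ⟨
    f x + 0ℤ                   ≤⟨ ℤₚ.+-monoʳ-≤ (f x) (∑-nonneg f (remove x xs) (0≤f ∘ ∈-remove⁻ xs)) ⟩
    f x + ∑ f (remove x xs)    ≡⟨ ∑-↭ f (remove-↭ x∈) ⟨
    ∑ f xs                     ∎
    where open ℤₚ.≤-Reasoning

module Extremes where

  open import Data.List.Base using ([]; _∷_)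
  open import Data.List.Membership.Propositional using (_∈_)
  open import Data.List.Relation.Unary.Any using (here; there)
  open import Data.Product using (∃-syntax; _×_; _,_)
  open import Data.Sum using (inj₁; inj₂)
  open import Relation.Binary.Core using (Rel)
  open import Relation.Binary.Definitions using (Total; Transitive)
  open import Relation.Binary.PropositionalEquality using (refl)
  open import Level using (0ℓ)

  module _ {A : Set} {_≼_ : Rel A 0ℓ} (total : Total _≼_) (trans : Transitive _≼_) where

    private
      refl≼ : ∀ {x} → x ≼ x
      refl≼ {x} with total x x
      ... | inj₁ x≼x = x≼x
      ... | inj₂ x≼x = x≼x

    least : ∀ x xs → ∃[ m ] m ∈ x ∷ xs × (∀ {y} → y ∈ x ∷ xs → m ≼ y)
    least x [] = x , here refl , λ where (here refl) → refl≼
    least x (z ∷ zs) with least z zs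
    ... | m , m∈ , m≼ with total x m
    ...   | inj₁ x≼m = x , here refl , λ where
                         (here refl) → refl≼
                         (there y∈)  → trans x≼m (m≼ y∈)
    ...   | inj₂ m≼x = m , there m∈ , λ where
                         (here refl) → m≼x
                         (there y∈)  → m≼ y∈

module ChipLists where

  open Fibonacci
  open IntegerFibonacci
  open import Data.Nat.Base as ℕ using (ℕ; zero; suc; _∸_; z≤n; s≤s)
  import Data.Nat.Properties as ℕₚ
  open import Data.Integer.Base as ℤ using (ℤ; +_; 0ℤ; _+_; _-_; _*_)
  import Data.Integer.Properties as ℤₚ
  open import Data.List.Base using (List; _∷_; length; replicate)
  open import Data.List.Properties using (length-replicate)
  open import Data.List.Membership.Propositional using (_∈_)
  open import Data.List.Relation.Binary.Permutation.Propositional using (_↭_)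
  open import Data.List.Relation.Binary.Permutation.Propositional.Properties using (↭-length)
  open import Data.Product using (∃-syntax; _×_; _,_)
  open import Relation.Nullary using (yes; no)
  open import Relation.Binary.PropositionalEquality
  open import Relation.Binary.Construct.Closure.ReflexiveTransitive using (Star; ε; _◅_)
  open import Data.Integer.Tactic.RingSolver using (solve-∀)
  open Multiset ℤₚ._≟_ public

  tally : List ℤ → State
  tally ℓ j = count j ℓ

  combineL : ℤ → List ℤ → List ℤ
  combineL i ℓ = i + + 2 ∷ remove (i + + 1) (remove i ℓ)

  splitL : ℤ → List ℤ → List ℤ
  splitL i ℓ = i - + 2 ∷ i + + 1 ∷ remove i (remove i ℓ)

  inc1-cong : ∀ x {a b} → a ≗ b → inc1 x a ≗ inc1 x b
  inc1-cong x a≗b j with j ℤₚ.≟ x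
  ... | yes _ = cong suc (a≗b j)
  ... | no _  = a≗b j

  dec1-cong : ∀ x {a b} → a ≗ b → dec1 x a ≗ dec1 x b
  dec1-cong x a≗b j with j ℤₚ.≟ x
  ... | yes _ = cong (_∸ 1) (a≗b j)
  ... | no _  = a≗b j

  tally-remove : ∀ x ℓ → tally (remove x ℓ) ≗ dec1 x (tally ℓ)
  tally-remove x ℓ j with j ℤₚ.≟ x
  ... | yes refl = count-remove-≡ j ℓ
  ... | no j≢x   = count-remove-≢ ℓ j≢x

  tally-combine : ∀ {a ℓ} i → a ≗ tally ℓ → combineAt a i ≗ tally (combineL i ℓ)
  tally-combine {a} {ℓ} i a≗ = inc1-cong (i + + 2) λ j → begin
    dec1 (i + + 1) (dec1 i a) j           ≡⟨ dec1-cong (i + + 1) (dec1-cong i a≗) j ⟩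
    dec1 (i + + 1) (dec1 i (tally ℓ)) j   ≡⟨ dec1-cong (i + + 1) (tally-remove i ℓ) j ⟨
    dec1 (i + + 1) (tally (remove i ℓ)) j ≡⟨ tally-remove (i + + 1) (remove i ℓ) j ⟨
    tally (remove (i + + 1) (remove i ℓ)) j ∎
    where open ≡-Reasoning

  tally-split : ∀ {a ℓ} i → a ≗ tally ℓ → splitAt a i ≗ tally (splitL i ℓ)
  tally-split {a} {ℓ} i a≗ = inc1-cong (i - + 2) (inc1-cong (i + + 1) λ j → begin
    dec1 i (dec1 i a) j           ≡⟨ dec1-cong i (dec1-cong i a≗) j ⟩
    dec1 i (dec1 i (tally ℓ)) j   ≡⟨ dec1-cong i (tally-remove i ℓ) j ⟨
    dec1 i (tally (remove i ℓ)) j ≡⟨ tally-remove i (remove i ℓ) j ⟨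
    tally (remove i (remove i ℓ)) j ∎)
    where open ≡-Reasoning

  Balanced : ℕ → List ℤ → Set
  Balanced n ℓ = ∀ J → ∑ (λ p → fibℤ (J + p)) ℓ ≡ + n * fibℤ J

  combine-chips : ∀ {a ℓ i} → a ≗ tally ℓ → 1 ℕ.≤ a i → 1 ℕ.≤ a (i + + 1) →
                  i ∈ ℓ × i + + 1 ∈ remove i ℓ
  combine-chips {a} {ℓ} {i} a≗ 1≤aᵢ 1≤aᵢ₊₁ =
    count-pos⇒∈ ℓ (subst (0 ℕ.<_) (a≗ i) 1≤aᵢ) ,
    ∈-remove⁺ i+1≢i (count-pos⇒∈ ℓ (subst (0 ℕ.<_) (a≗ (i + + 1)) 1≤aᵢ₊₁))
    where
    i+1≢i : i + + 1 ≢ i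
    i+1≢i i+1≡i = ℤₚ.i≢suc[i] (sym (trans (ℤₚ.+-comm (+ 1) i) i+1≡i))

  split-chips : ∀ {a ℓ i} → a ≗ tally ℓ → 2 ℕ.≤ a i → i ∈ ℓ × i ∈ remove i ℓ
  split-chips {a} {ℓ} {i} a≗ 2≤aᵢ =
    count-pos⇒∈ ℓ (ℕₚ.≤-trans (s≤s z≤n) 2≤count) ,
    count-pos⇒∈ (remove i ℓ) (subst (0 ℕ.<_) (sym (count-remove-≡ i ℓ)) (ℕₚ.∸-monoˡ-≤ 1 2≤count))
    where
    2≤count = subst (2 ℕ.≤_) (a≗ i) 2≤aᵢ

  balanced-combine : ∀ {n ℓ i} → i ∈ ℓ → i + + 1 ∈ remove i ℓ → Balanced n ℓ → Balanced n (combineL i ℓ)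
  balanced-combine {n} {ℓ} {i} i∈ i+1∈ bal J = begin
    f (i + + 2) + ∑ f rest           ≡⟨ cong (_+ ∑ f rest) (fibℤ-combine J i) ⟨
    (f i + f (i + + 1)) + ∑ f rest   ≡⟨ ℤₚ.+-assoc (f i) _ _ ⟩
    f i + (f (i + + 1) + ∑ f rest)   ≡⟨ ∑-↭ f (remove₂-↭ i∈ i+1∈) ⟨
    ∑ f ℓ                            ≡⟨ bal J ⟩
    + n * fibℤ J                     ∎
    where
    open ≡-Reasoning
    f = λ p → fibℤ (J + p)
    rest = remove (i + + 1) (remove i ℓ)

  balanced-split : ∀ {n ℓ i} → i ∈ ℓ → i ∈ remove i ℓ → Balanced n ℓ → Balanced n (splitL i ℓ)
  balanced-split {n} {ℓ} {i} i∈ i∈′ bal J = begin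
    f (i - + 2) + (f (i + + 1) + ∑ f rest) ≡⟨ ℤₚ.+-assoc (f (i - + 2)) _ _ ⟨
    (f (i - + 2) + f (i + + 1)) + ∑ f rest ≡⟨ cong (_+ ∑ f rest) (fibℤ-split J i) ⟨
    (f i + f i) + ∑ f rest                 ≡⟨ ℤₚ.+-assoc (f i) _ _ ⟩
    f i + (f i + ∑ f rest)                 ≡⟨ ∑-↭ f (remove₂-↭ i∈ i∈′) ⟨
    ∑ f ℓ                                  ≡⟨ bal J ⟩
    + n * fibℤ J                           ∎
    where
    open ≡-Reasoning
    f = λ p → fibℤ (J + p)
    rest = remove i (remove i ℓ)

  length-combine : ∀ {ℓ i} → i ∈ ℓ → i + + 1 ∈ remove i ℓ → suc (length (combineL i ℓ)) ≡ length ℓ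
  length-combine i∈ i+1∈ = sym (↭-length (remove₂-↭ i∈ i+1∈))

  length-split : ∀ {ℓ i} → i ∈ ℓ → i ∈ remove i ℓ → length (splitL i ℓ) ≡ length ℓ
  length-split i∈ i∈′ = sym (↭-length (remove₂-↭ i∈ i∈′))

  reachable-chips : ∀ {n a b} → Star Move a b → ∀ ℓ → a ≗ tally ℓ → Balanced n ℓ → length ℓ ℕ.≤ n →
                    ∃[ ℓ′ ] b ≗ tally ℓ′ × Balanced n ℓ′ × length ℓ′ ℕ.≤ n
  reachable-chips ε ℓ a≗ bal len = ℓ , a≗ , bal , len
  reachable-chips {n} (combine i 1≤aᵢ 1≤aᵢ₊₁ ◅ moves) ℓ a≗ bal len
    with i∈ , i+1∈ ← combine-chips {ℓ = ℓ} a≗ 1≤aᵢ 1≤aᵢ₊₁ =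
    reachable-chips moves (combineL i ℓ) (tally-combine {ℓ = ℓ} i a≗) (balanced-combine {n} i∈ i+1∈ bal)
      (ℕₚ.≤-trans (ℕₚ.≤-trans (ℕₚ.n≤1+n _) (ℕₚ.≤-reflexive (length-combine i∈ i+1∈))) len)
  reachable-chips {n} (split i 2≤aᵢ ◅ moves) ℓ a≗ bal len
    with i∈ , i∈′ ← split-chips {ℓ = ℓ} a≗ 2≤aᵢ =
    reachable-chips moves (splitL i ℓ) (tally-split {ℓ = ℓ} i a≗) (balanced-split {n} i∈ i∈′ bal)
      (ℕₚ.≤-trans (ℕₚ.≤-reflexive (length-split i∈ i∈′)) len)

  start≗tally : ∀ n → start n ≗ tally (replicate n 0ℤ)
  start≗tally zero    j with j ℤₚ.≟ 0ℤ
  ... | yes _ = refl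
  ... | no _  = refl
  start≗tally (suc n) j with j ℤₚ.≟ 0ℤ | start≗tally n j
  ... | yes _ | ih = cong suc ih
  ... | no _  | ih = ih

  balanced-start : ∀ n → Balanced n (replicate n 0ℤ)
  balanced-start zero    J = refl
  balanced-start (suc n) J = begin
    fibℤ (J + 0ℤ) + ∑ (λ p → fibℤ (J + p)) (replicate n 0ℤ)
      ≡⟨ cong₂ _+_ (cong fibℤ (ℤₚ.+-identityʳ J)) (balanced-start n J) ⟩
    fibℤ J + + n * fibℤ J
      ≡⟨ one-more (fibℤ J) (+ n) ⟩
    + suc n * fibℤ J ∎
    where
    open ≡-Reasoning
    one-more : ∀ x m → x + m * x ≡ (+ 1 + m) * x
    one-more = solve-∀

  chips-of-reachable : ∀ {n T} → Reachable (start n) T →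
                       ∃[ ℓ ] T ≗ tally ℓ × Balanced n ℓ × length ℓ ℕ.≤ n
  chips-of-reachable {n} moves = reachable-chips moves (replicate n 0ℤ) (start≗tally n) (balanced-start n)
                                                 (ℕₚ.≤-reflexive (length-replicate n))

module Digits where

  open Fibonacci
  open IntegerFibonacci
  open import Data.Nat.Base as ℕ using (ℕ; zero; suc; z≤n; s≤s)
  import Data.Nat.Properties as ℕₚ
  open import Data.Integer.Base using (ℤ; +_; 0ℤ; 1ℤ; -_; _+_; _-_; _*_; _≤_; +≤+)
  import Data.Integer.Properties as ℤₚ
  open import Data.Product using (_×_; _,_; proj₁; proj₂)
  open import Data.Sum using (_⊎_; inj₁; inj₂)
  open import Relation.Nullary using (yes; no; contradiction)
  open import Relation.Binary.PropositionalEquality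
  open import Data.Integer.Tactic.RingSolver using (solve-∀)
  import Data.Nat.Tactic.RingSolver as ℕ-Solver
  open import Function using (_∘_)

  σ : (ℕ → ℕ) → ℕ → ℤ
  σ c zero    = 0ℤ
  σ c (suc j) = + (c (suc j) ℕ.* fib (suc j)) - σ c j

  total : (ℕ → ℕ) → ℕ → ℕ
  total c zero    = c 0
  total c (suc j) = total c j ℕ.+ c (suc j)

  -- c 0 is left free: σ ignores it since F₀ = 0.
  Binary : ℕ → (ℕ → ℕ) → Set
  Binary j c = ∀ {r} → 0 ℕ.< r → r ℕ.≤ j → c r ℕ.≤ 1

  digit*fib≤fib : ∀ {d} k → d ℕ.≤ 1 → + (d ℕ.* fib k) ≤ + fib k
  digit*fib≤fib {d} k d≤1 =
    +≤+ (ℕₚ.≤-trans (ℕₚ.*-monoˡ-≤ (fib k) d≤1) (ℕₚ.≤-reflexive (ℕₚ.*-identityˡ (fib k))))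

  σ-bounds : ∀ c j → Binary j c → - + fib j ≤ σ c j × σ c j ≤ + fib (suc j)
  σ-bounds c zero    _   = ℤₚ.≤-refl , +≤+ z≤n
  σ-bounds c (suc j) bin = lower , upper
    where
    ih = σ-bounds c j (λ 0<r r≤j → bin 0<r (ℕₚ.m≤n⇒m≤1+n r≤j))
    lower : - + fib (suc j) ≤ σ c (suc j)
    lower = begin
      - + fib (suc j)                                ≡⟨ ℤₚ.+-identityˡ _ ⟨
      0ℤ - + fib (suc j)                             ≤⟨ ℤₚ.+-mono-≤ (+≤+ z≤n) (ℤₚ.neg-mono-≤ (proj₂ ih)) ⟩
      + (c (suc j) ℕ.* fib (suc j)) - σ c j          ∎
      where open ℤₚ.≤-Reasoning
    upper : σ c (suc j) ≤ + fib (2 ℕ.+ j)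
    upper = begin
      + (c (suc j) ℕ.* fib (suc j)) - σ c j          ≤⟨ ℤₚ.+-mono-≤ (digit*fib≤fib (suc j) (bin (s≤s z≤n) ℕₚ.≤-refl))
                                                                     (ℤₚ.neg-mono-≤ (proj₁ ih)) ⟩
      + fib (suc j) - - + fib j                      ≡⟨ cong (_+_ (+ fib (suc j))) (ℤₚ.neg-involutive (+ fib j)) ⟩
      + fib (2 ℕ.+ j)                                ∎
      where open ℤₚ.≤-Reasoning

  σ-step-0 : ∀ c j → c (suc j) ≡ 0 → σ c (suc j) ≡ - σ c j
  σ-step-0 c j cⱼ≡0 rewrite cⱼ≡0 = ℤₚ.+-identityˡ (- σ c j)

  σ-step-1 : ∀ c j → c (suc j) ≡ 1 → σ c (suc j) ≡ + fib (suc j) - σ c j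
  σ-step-1 c j cⱼ≡1 rewrite cⱼ≡1 = cong (λ x → + x - σ c j) (ℕₚ.+-identityʳ (fib (suc j)))

  σ-top : ∀ c j → 1 ℕ.≤ c (2 ℕ.+ j) → c (1 ℕ.+ j) ≡ 0 → Binary j c → + fib (1 ℕ.+ j) ≤ σ c (2 ℕ.+ j)
  σ-top c j 1≤c c≡0 bin = begin
    + fib (1 ℕ.+ j)                                    ≡⟨ add-sub (+ fib (1 ℕ.+ j)) (+ fib j) ⟩
    + fib (2 ℕ.+ j) - + fib j                          ≤⟨ ℤₚ.+-mono-≤ (+≤+ F≤cF) (ℤₚ.neg-mono-≤ σ≤F) ⟩
    σ c (2 ℕ.+ j)                                      ∎
    where
    open ℤₚ.≤-Reasoning
    σ≤F : σ c (1 ℕ.+ j) ≤ + fib j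
    σ≤F = begin
      σ c (1 ℕ.+ j)  ≡⟨ σ-step-0 c j c≡0 ⟩
      - σ c j        ≤⟨ ℤₚ.neg-mono-≤ (proj₁ (σ-bounds c j bin)) ⟩
      - - + fib j    ≡⟨ ℤₚ.neg-involutive _ ⟩
      + fib j        ∎
    F≤cF : fib (2 ℕ.+ j) ℕ.≤ c (2 ℕ.+ j) ℕ.* fib (2 ℕ.+ j)
    F≤cF = ℕₚ.≤-trans (ℕₚ.≤-reflexive (sym (ℕₚ.*-identityˡ _))) (ℕₚ.*-monoˡ-≤ (fib (2 ℕ.+ j)) 1≤c)
    add-sub : ∀ x y → x ≡ x + y - y
    add-sub = solve-∀

  digit-cases : ∀ {d} → d ℕ.≤ 1 → d ≡ 0 ⊎ d ≡ 1
  digit-cases {zero}  _         = inj₁ refl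
  digit-cases {suc zero} _      = inj₂ refl
  digit-cases {suc (suc _)} (s≤s ())

  total≤ : ∀ c j → (∀ r → c r ℕ.≤ 1) → total c j ℕ.≤ suc j
  total≤ c zero    bin = bin 0
  total≤ c (suc j) bin =
    ℕₚ.≤-trans (ℕₚ.+-mono-≤ (total≤ c j bin) (bin (suc j))) (ℕₚ.≤-reflexive (ℕₚ.+-comm (suc j) 1))

  NearMax : ℕ → (ℕ → ℕ) → ℕ → Set
  NearMax B c j = + fib (suc j) ≤ σ c j + + B

  near-max-1 : ∀ c j {B} → c (suc j) ≡ 1 → NearMax B c (suc j) → + fib j + σ c j ≤ + B
  near-max-1 c j {B} c≡1 near = begin
    + fib j + σ c j                                           ≡⟨ shift (+ fib (1 ℕ.+ j)) (+ fib j) (σ c j) ⟩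
    + fib (2 ℕ.+ j) + (σ c j - + fib (1 ℕ.+ j))               ≤⟨ ℤₚ.+-monoˡ-≤ _ near ⟩
    σ c (suc j) + + B + (σ c j - + fib (1 ℕ.+ j))
      ≡⟨ cong (λ s → s + + B + (σ c j - + fib (1 ℕ.+ j))) (σ-step-1 c j c≡1) ⟩
    + fib (1 ℕ.+ j) - σ c j + + B + (σ c j - + fib (1 ℕ.+ j)) ≡⟨ cancel (+ fib (1 ℕ.+ j)) (σ c j) (+ B) ⟩
    + B                                                       ∎
    where
    open ℤₚ.≤-Reasoning
    shift : ∀ a b s → b + s ≡ (a + b) + (s - a)
    shift = solve-∀
    cancel : ∀ a s b → a - s + b + (s - a) ≡ b
    cancel = solve-∀

  near-max-0 : ∀ c j {B} → c (2 ℕ.+ j) ≡ 0 → Binary (1 ℕ.+ j) c → NearMax B c (2 ℕ.+ j) →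
               fib (2 ℕ.+ j) ℕ.≤ B
  near-max-0 c j {B} top≡0 bin near = ℕₚ.+-cancelʳ-≤ (fib (1 ℕ.+ j)) _ _
    (ℕₚ.≤-trans (ℤₚ.drop‿+≤+ F₃≤F₁+B) (ℕₚ.≤-reflexive (ℕₚ.+-comm (fib (1 ℕ.+ j)) B)))
    where
    open ℤₚ.≤-Reasoning
    F₃≤F₁+B : + fib (3 ℕ.+ j) ≤ + fib (1 ℕ.+ j) + + B
    F₃≤F₁+B = begin
      + fib (3 ℕ.+ j)                 ≤⟨ near ⟩
      σ c (2 ℕ.+ j) + + B             ≡⟨ cong (_+ + B) (σ-step-0 c (suc j) top≡0) ⟩
      - σ c (1 ℕ.+ j) + + B           ≤⟨ ℤₚ.+-monoˡ-≤ (+ B) (ℤₚ.neg-mono-≤ (proj₁ (σ-bounds c _ bin))) ⟩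
      - - + fib (1 ℕ.+ j) + + B       ≡⟨ cong (_+ + B) (ℤₚ.neg-involutive (+ fib (1 ℕ.+ j))) ⟩
      + fib (1 ℕ.+ j) + + B           ∎

  near-max-11 : ∀ c j {B} → c (2 ℕ.+ j) ≡ 1 → c (1 ℕ.+ j) ≡ 1 → Binary j c → NearMax B c (2 ℕ.+ j) →
                fib (1 ℕ.+ j) ℕ.≤ B
  near-max-11 c j {B} top≡1 next≡1 bin near = ℤₚ.drop‿+≤+ (begin
    + fib (1 ℕ.+ j)                      ≡⟨ ℤₚ.+-identityʳ _ ⟨
    + fib (1 ℕ.+ j) + 0ℤ                 ≤⟨ ℤₚ.+-monoʳ-≤ (+ fib (1 ℕ.+ j)) 0≤σ ⟩
    + fib (1 ℕ.+ j) + σ c (1 ℕ.+ j)      ≤⟨ near-max-1 c (suc j) top≡1 near ⟩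
    + B                                  ∎)
    where
    open ℤₚ.≤-Reasoning
    0≤σ : 0ℤ ≤ σ c (1 ℕ.+ j)
    0≤σ = begin
      0ℤ                          ≤⟨ ℤₚ.i≤j⇒0≤j-i (proj₂ (σ-bounds c j bin)) ⟩
      + fib (1 ℕ.+ j) - σ c j     ≡⟨ σ-step-1 c j next≡1 ⟨
      σ c (1 ℕ.+ j)               ∎

  near-max-10 : ∀ c j {B} → c (2 ℕ.+ j) ≡ 1 → c (1 ℕ.+ j) ≡ 0 → NearMax B c (2 ℕ.+ j) → NearMax B c j
  near-max-10 c j {B} top≡1 next≡0 near = begin
    + fib (1 ℕ.+ j)                            ≡⟨ cancel (+ fib (1 ℕ.+ j)) (σ c j) ⟩
    + fib (1 ℕ.+ j) + - σ c j + σ c j          ≤⟨ ℤₚ.+-monoˡ-≤ (σ c j) F-σ≤B ⟩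
    + B + σ c j                                ≡⟨ ℤₚ.+-comm (+ B) (σ c j) ⟩
    σ c j + + B                                ∎
    where
    open ℤₚ.≤-Reasoning
    F-σ≤B : + fib (1 ℕ.+ j) + - σ c j ≤ + B
    F-σ≤B = subst (λ s → + fib (1 ℕ.+ j) + s ≤ + B) (σ-step-0 c j next≡0) (near-max-1 c (suc j) top≡1 near)
    cancel : ∀ f s → f ≡ f + - s + s
    cancel = solve-∀

  near-max-top : ∀ c j {B} → c (suc j) ≡ 1 → σ c (suc j) ≤ + B → NearMax B c j
  near-max-top c j {B} top≡1 σ≤B = begin
    + fib (suc j)                    ≡⟨ cancel (+ fib (suc j)) (σ c j) ⟩
    + fib (suc j) - σ c j + σ c j    ≡⟨ cong (_+ σ c j) (σ-step-1 c j top≡1) ⟨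
    σ c (suc j) + σ c j              ≤⟨ ℤₚ.+-monoˡ-≤ (σ c j) σ≤B ⟩
    + B + σ c j                      ≡⟨ ℤₚ.+-comm (+ B) (σ c j) ⟩
    σ c j + + B                      ∎
    where
    open ℤₚ.≤-Reasoning
    cancel : ∀ f s → f ≡ f - s + s
    cancel = solve-∀

  -- Near its maximum, σ forces the digits above the level where F exceeds B to read 1 0 1 0 …,
  -- so only every other position there can carry a chip.
  sparse : ∀ {B L} c → B ℕ.< fib L → (∀ r → c r ℕ.≤ 1) →
           ∀ j → NearMax B c j → 2 ℕ.* total c j ℕ.≤ j ℕ.+ L ℕ.+ 2
  sparse {L = L} c B<F bin zero _ = ℕₚ.≤-trans (ℕₚ.*-monoʳ-≤ 2 (bin 0)) (ℕₚ.m≤n+m 2 L)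
  sparse {L = zero}  c ()  bin (suc zero) _
  sparse {L = suc L} c B<F bin (suc zero) _ =
    ℕₚ.≤-trans (ℕₚ.*-monoʳ-≤ 2 (ℕₚ.+-mono-≤ (bin 0) (bin 1))) (s≤s (ℕₚ.+-monoˡ-≤ 2 (s≤s z≤n)))
  sparse {B} {L} c B<F bin (suc (suc j)) near with fib (suc j) ℕₚ.≤? B
  ... | yes F≤B = begin
    2 ℕ.* total c (2 ℕ.+ j)                ≤⟨ ℕₚ.*-monoʳ-≤ 2 (total≤ c (2 ℕ.+ j) bin) ⟩
    2 ℕ.* (3 ℕ.+ j)                        ≡⟨ double (2 ℕ.+ j) ⟩
    (2 ℕ.+ j) ℕ.+ (2 ℕ.+ j) ℕ.+ 2          ≤⟨ ℕₚ.+-monoˡ-≤ 2 (ℕₚ.+-monoʳ-≤ (2 ℕ.+ j) 2+j≤L) ⟩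
    (2 ℕ.+ j) ℕ.+ L ℕ.+ 2                  ∎
    where
    open ℕₚ.≤-Reasoning
    2+j≤L : 2 ℕ.+ j ℕ.≤ L
    2+j≤L = ℕₚ.≰⇒> λ L≤1+j → ℕₚ.<⇒≱ B<F (ℕₚ.≤-trans (fib-mono L≤1+j) F≤B)
    double : ∀ m → 2 ℕ.* (1 ℕ.+ m) ≡ m ℕ.+ m ℕ.+ 2
    double = ℕ-Solver.solve-∀
  ... | no F≰B with digit-cases (bin (2 ℕ.+ j)) | digit-cases (bin (1 ℕ.+ j))
  ...   | inj₁ top≡0 | _           =
    contradiction (ℕₚ.≤-trans (fib[n]≤fib[1+n] (suc j)) (near-max-0 c j top≡0 (λ _ _ → bin _) near)) F≰B
  ...   | inj₂ top≡1 | inj₂ next≡1 = contradiction (near-max-11 c j top≡1 next≡1 (λ _ _ → bin _) near) F≰B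
  ...   | inj₂ top≡1 | inj₁ next≡0 = begin
    2 ℕ.* (total c j ℕ.+ c (1 ℕ.+ j) ℕ.+ c (2 ℕ.+ j))
      ≡⟨ cong₂ (λ x y → 2 ℕ.* (total c j ℕ.+ x ℕ.+ y)) next≡0 top≡1 ⟩
    2 ℕ.* (total c j ℕ.+ 0 ℕ.+ 1)
      ≡⟨ regroup (total c j) ⟩
    2 ℕ.+ 2 ℕ.* total c j
      ≤⟨ ℕₚ.+-monoʳ-≤ 2 (sparse c B<F bin j (near-max-10 c j top≡1 next≡0 near)) ⟩
    2 ℕ.+ (j ℕ.+ L ℕ.+ 2) ∎
    where
    open ℕₚ.≤-Reasoning
    regroup : ∀ t → 2 ℕ.* (t ℕ.+ 0 ℕ.+ 1) ≡ 2 ℕ.+ 2 ℕ.* t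
    regroup = ℕ-Solver.solve-∀

  sparse-top : ∀ {B L} c R → B ℕ.< fib L → (∀ r → c r ℕ.≤ 1) → c R ≡ 1 → σ c R ≤ + B →
               2 ℕ.* total c R ℕ.≤ R ℕ.+ L ℕ.+ 3
  sparse-top {L = L} c zero B<F bin c₀≡1 _ rewrite c₀≡1 = ℕₚ.≤-trans (ℕₚ.n≤1+n 2) (ℕₚ.m≤n+m 3 L)
  sparse-top {B} {L} c (suc j) B<F bin top≡1 σ≤B = begin
    2 ℕ.* (total c j ℕ.+ c (suc j))    ≡⟨ cong (λ d → 2 ℕ.* (total c j ℕ.+ d)) top≡1 ⟩
    2 ℕ.* (total c j ℕ.+ 1)            ≡⟨ ℕₚ.*-distribˡ-+ 2 (total c j) 1 ⟩
    2 ℕ.* total c j ℕ.+ 2              ≤⟨ ℕₚ.+-monoˡ-≤ 2 (sparse c B<F bin j (near-max-top c j top≡1 σ≤B)) ⟩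
    j ℕ.+ L ℕ.+ 2 ℕ.+ 2                ≡⟨ regroup j L ⟩
    suc j ℕ.+ L ℕ.+ 3                  ∎
    where
    open ℕₚ.≤-Reasoning
    regroup : ∀ j L → j ℕ.+ L ℕ.+ 2 ℕ.+ 2 ≡ suc j ℕ.+ L ℕ.+ 3
    regroup = ℕ-Solver.solve-∀

  σ-cong : ∀ {c d} N → (∀ {r} → r ℕ.≤ N → c r ≡ d r) → σ c N ≡ σ d N
  σ-cong zero    _   = refl
  σ-cong (suc N) c≗d =
    cong₂ (λ x s → + (x ℕ.* fib (suc N)) - s) (c≗d ℕₚ.≤-refl) (σ-cong N (c≗d ∘ ℕₚ.m≤n⇒m≤1+n))

  total-cong : ∀ {c d} N → (∀ {r} → r ℕ.≤ N → c r ≡ d r) → total c N ≡ total d N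
  total-cong zero    c≗d = c≗d z≤n
  total-cong (suc N) c≗d = cong₂ ℕ._+_ (total-cong N (c≗d ∘ ℕₚ.m≤n⇒m≤1+n)) (c≗d ℕₚ.≤-refl)

  Bump : ℕ → (ℕ → ℕ) → (ℕ → ℕ) → Set
  Bump x c d = d x ≡ suc (c x) × (∀ {r} → r ≢ x → d r ≡ c r)

  below-bump : ∀ {x c d N} → Bump x c d → N ℕ.< x → ∀ {r} → r ℕ.≤ N → c r ≡ d r
  below-bump (_ , same) N<x r≤N = sym (same λ { refl → ℕₚ.<⇒≱ N<x r≤N })

  σ-bump : ∀ {x c d} N → x ℕ.≤ N → Bump x c d → σ d N ≡ σ c N - alt N * negFib x
  σ-bump zero z≤n _ = refl
  σ-bump {x} {c} {d} (suc N) x≤1+N bump@(bumped , same) with x ℕₚ.≟ suc N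
  ... | yes refl = begin
    + (d (suc N) ℕ.* F) - σ d N
      ≡⟨ cong₂ (λ e s → + (e ℕ.* F) - s) bumped (sym (σ-cong N (below-bump bump ℕₚ.≤-refl))) ⟩
    + F + y - σ c N                             ≡⟨ unit (+ F) y (σ c N) ⟩
    y - σ c N + 1ℤ * + F                        ≡⟨ cong (λ u → y - σ c N + u * + F) (alt*alt N) ⟨
    y - σ c N + alt N * alt N * + F             ≡⟨ square y (σ c N) (alt N) (+ F) ⟩
    σ c (suc N) - alt (suc N) * negFib (suc N)  ∎
    where
    open ≡-Reasoning
    F = fib (suc N)
    y = + (c (suc N) ℕ.* F)
    unit : ∀ f y s → f + y - s ≡ y - s + 1ℤ * f
    unit = solve-∀
    square : ∀ y s a f → y - s + a * a * f ≡ y - s - (- a) * (a * f)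
    square = solve-∀
  ... | no x≢1+N = begin
    + (d (suc N) ℕ.* F) - σ d N
      ≡⟨ cong₂ (λ e s → + (e ℕ.* F) - s) (same (x≢1+N ∘ sym)) (σ-bump N x≤N bump) ⟩
    y - (σ c N - alt N * negFib x)    ≡⟨ flip y (σ c N) (alt N) (negFib x) ⟩
    y - σ c N - (- alt N) * negFib x  ∎
    where
    open ≡-Reasoning
    F = fib (suc N)
    y = + (c (suc N) ℕ.* F)
    x≤N : x ℕ.≤ N
    x≤N = ℕₚ.≤-pred (ℕₚ.≤∧≢⇒< x≤1+N x≢1+N)
    flip : ∀ y s a t → y - (s - a * t) ≡ y - s - (- a) * t
    flip = solve-∀

  total-bump : ∀ {x c d} N → x ℕ.≤ N → Bump x c d → total d N ≡ suc (total c N)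
  total-bump zero z≤n (bumped , _) = bumped
  total-bump {x} {c} {d} (suc N) x≤1+N bump@(bumped , same) with x ℕₚ.≟ suc N
  ... | yes refl = trans (cong₂ ℕ._+_ (sym (total-cong N (below-bump bump ℕₚ.≤-refl))) bumped)
                         (ℕₚ.+-suc (total c N) (c (suc N)))
  ... | no x≢1+N =
    cong₂ ℕ._+_ (total-bump N (ℕₚ.≤-pred (ℕₚ.≤∧≢⇒< x≤1+N x≢1+N)) bump) (same (x≢1+N ∘ sym))

module Depths where

  open Fibonacci
  open IntegerFibonacci
  open Digits
  open import Data.Nat.Base as ℕ using (ℕ; zero; suc; _+_; _*_; _∸_; _≤_; _<_; z≤n; s≤s)
  import Data.Nat.Properties as ℕₚ
  open import Data.Integer.Base as ℤ using (ℤ; 0ℤ; -_; ∣_∣)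
  import Data.Integer.Properties as ℤₚ
  open import Data.List.Base using (List; []; _∷_; length; map)
  open import Data.List.Membership.Propositional using (_∈_)
  open import Data.List.Relation.Unary.Any using (here; there)
  open import Data.List.Relation.Binary.Permutation.Propositional using (_↭_)
  open import Data.List.Relation.Binary.Permutation.Propositional.Properties using (↭-length; map⁺)
  open import Data.Nat.ListAction using (sum)
  open import Data.Nat.ListAction.Properties using (sum-↭)
  open import Data.Product using (∃-syntax; _×_; _,_)
  open import Relation.Nullary using (¬_; yes; no)
  open import Data.Empty using (⊥-elim)
  open import Data.Sum using (_⊎_; inj₁; inj₂)
  open import Data.List.Membership.DecPropositional ℕₚ._≟_ using (_∈?_)
  open import Data.List.Membership.Propositional using (find; lose)
  open import Data.List.Relation.Unary.Any using (any?)
  open import Relation.Nullary.Decidable using (_×-dec_)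
  open import Relation.Unary using (Decidable)
  open import Induction.WellFounded using (Acc; acc)
  open import Data.Nat.Induction using (<-wellFounded)
  open Extremes using (least)
  open import Relation.Binary.PropositionalEquality
  open import Function using (_∘_)
  open import Data.Nat.Tactic.RingSolver using (solve-∀)
  import Data.Integer.Tactic.RingSolver as ℤ-Solver
  open Multiset ℕₚ._≟_ public

  value : List ℕ → ℤ
  value = ∑ negFib

  digits : List ℕ → ℕ → ℕ
  digits ds r = count r ds

  Bounded : ℕ → List ℕ → Set
  Bounded hi ds = ∀ {r} → r ∈ ds → r ≤ hi

  digits-bump : ∀ x ds → Bump x (digits ds) (digits (x ∷ ds))
  digits-bump x ds = count-∷-≡ ds refl , count-∷-≢ ds

  σ-nil : ∀ N → σ (digits []) N ≡ 0ℤ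
  σ-nil zero    = refl
  σ-nil (suc N) = cong (ℤ._-_ 0ℤ) (σ-nil N)

  σ-digits : ∀ N ds → Bounded N ds → σ (digits ds) N ≡ - (alt N ℤ.* value ds)
  σ-digits N []       _   = trans (σ-nil N) (annihilate (alt N))
    where
    annihilate : ∀ a → 0ℤ ≡ - (a ℤ.* 0ℤ)
    annihilate = ℤ-Solver.solve-∀
  σ-digits N (x ∷ ds) bnd = begin
    σ (digits (x ∷ ds)) N                           ≡⟨ σ-bump N (bnd (here refl)) (digits-bump x ds) ⟩
    σ (digits ds) N ℤ.- alt N ℤ.* negFib x
      ≡⟨ cong (ℤ._- alt N ℤ.* negFib x) (σ-digits N ds (bnd ∘ there)) ⟩
    - (alt N ℤ.* value ds) ℤ.- alt N ℤ.* negFib x   ≡⟨ distrib (alt N) (value ds) (negFib x) ⟩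
    - (alt N ℤ.* (negFib x ℤ.+ value ds))           ∎
    where
    open ≡-Reasoning
    distrib : ∀ a v f → - (a ℤ.* v) ℤ.- a ℤ.* f ≡ - (a ℤ.* (f ℤ.+ v))
    distrib = ℤ-Solver.solve-∀

  ∣σ-digits∣ : ∀ N ds → Bounded N ds → ∣ σ (digits ds) N ∣ ≡ ∣ value ds ∣
  ∣σ-digits∣ N ds bnd = begin
    ∣ σ (digits ds) N ∣             ≡⟨ cong ∣_∣ (σ-digits N ds bnd) ⟩
    ∣ - (alt N ℤ.* value ds) ∣      ≡⟨ ℤₚ.∣-i∣≡∣i∣ (alt N ℤ.* value ds) ⟩
    ∣ alt N ℤ.* value ds ∣          ≡⟨ ℤₚ.∣i*j∣≡∣i∣*∣j∣ (alt N) (value ds) ⟩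
    ∣ alt N ∣ * ∣ value ds ∣        ≡⟨ cong (_* ∣ value ds ∣) (∣alt∣ N) ⟩
    1 * ∣ value ds ∣                ≡⟨ ℕₚ.*-identityˡ _ ⟩
    ∣ value ds ∣                    ∎
    where open ≡-Reasoning

  total-nil : ∀ N → total (digits []) N ≡ 0
  total-nil zero    = refl
  total-nil (suc N) = cong (_+ 0) (total-nil N)

  total-digits : ∀ N ds → Bounded N ds → total (digits ds) N ≡ length ds
  total-digits N []       _   = total-nil N
  total-digits N (x ∷ ds) bnd =
    trans (total-bump N (bnd (here refl)) (digits-bump x ds)) (cong suc (total-digits N ds (bnd ∘ there)))

  ValueBound : List ℕ → Set
  ValueBound ds = ∀ {x} → x ∈ ds → ∀ k → k + 2 * length ds ≤ x + 2 → fib k ≤ ∣ value ds ∣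

  Dominates : List ℕ → List ℕ → Set
  Dominates ds ds′ = ∀ {x} → x ∈ ds → ∃[ x′ ] x′ ∈ ds′ × x + 2 * length ds′ ≤ x′ + 2 * length ds

  transfer : ∀ {ds ds′} → value ds′ ≡ value ds → Dominates ds ds′ → ValueBound ds′ → ValueBound ds
  transfer {ds} {ds′} same dom bound′ {x} x∈ k k≤ with dom x∈
  ... | x′ , x′∈ , x≤x′ = subst (λ v → fib k ≤ ∣ v ∣) same (bound′ x′∈ k k≤′)
    where
    open ℕₚ.≤-Reasoning
    L = 2 * length ds
    L′ = 2 * length ds′
    k≤′ : k + L′ ≤ x′ + 2
    k≤′ = ℕₚ.+-cancelʳ-≤ (x + L) _ _ (begin
      k + L′ + (x + L)          ≡⟨ interchange k L′ x L ⟩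
      (k + L) + (x + L′)        ≤⟨ ℕₚ.+-mono-≤ k≤ x≤x′ ⟩
      (x + 2) + (x′ + L)        ≡⟨ interchange′ x x′ L ⟩
      x′ + 2 + (x + L)          ∎)
      where
      interchange : ∀ a b c d → a + b + (c + d) ≡ (a + d) + (c + b)
      interchange = solve-∀
      interchange′ : ∀ a b c → (a + 2) + (b + c) ≡ b + 2 + (a + c)
      interchange′ = solve-∀

  weight : ℕ → ℕ → ℕ
  weight hi r = hi + 2 ∸ r

  potential : ℕ → List ℕ → ℕ
  potential hi ds = sum (map (weight hi) ds)

  record Reduction (hi : ℕ) (ds ds′ : List ℕ) : Set where
    field
      same-value   : value ds′ ≡ value ds
      dominates    : Dominates ds ds′
      bounded      : Bounded hi ds′
      smaller      : potential hi ds′ < potential hi ds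

  combineD : ℕ → List ℕ → List ℕ
  combineD q ds = q ∷ remove (2 + q) (remove (1 + q) ds)

  splitD : ℕ → List ℕ → List ℕ
  splitD q ds = q ∷ 3 + q ∷ remove (1 + q) (remove (1 + q) ds)

  weight-at : ∀ {hi} r e → hi ≡ r + e → weight hi r ≡ 2 + e
  weight-at r e refl = trans (cong (_∸ r) (regroup r e)) (ℕₚ.m+n∸m≡n r (2 + e))
    where
    regroup : ∀ r e → r + e + 2 ≡ r + (2 + e)
    regroup = solve-∀

  weight-combine : ∀ {hi} q → 2 + q ≤ hi → weight hi q < weight hi (1 + q) + weight hi (2 + q)
  weight-combine q 2+q≤hi with d , refl ← ℕₚ.m≤n⇒∃[o]m+o≡n 2+q≤hi = begin-strict
    weight (2 + q + d) q                                     ≡⟨ weight-at q (2 + d) (shift₀ q d) ⟩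
    4 + d                                                    <⟨ ℕₚ.m≤m+n (5 + d) d ⟩
    5 + d + d                                                ≡⟨ regroup d ⟩
    (3 + d) + (2 + d)                                        ≡⟨ cong₂ _+_ (weight-at (1 + q) (1 + d) (shift₁ q d))
                                                                          (weight-at (2 + q) d refl) ⟨
    weight (2 + q + d) (1 + q) + weight (2 + q + d) (2 + q)  ∎
    where
    open ℕₚ.≤-Reasoning
    shift₀ : ∀ q d → 2 + q + d ≡ q + (2 + d)
    shift₀ = solve-∀
    shift₁ : ∀ q d → 2 + q + d ≡ 1 + q + (1 + d)
    shift₁ = solve-∀
    regroup : ∀ d → 5 + d + d ≡ (3 + d) + (2 + d)
    regroup = solve-∀

  weight-split : ∀ {hi} q → 3 + q ≤ hi → weight hi q + weight hi (3 + q) < weight hi (1 + q) + weight hi (1 + q)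
  weight-split q 3+q≤hi with d , refl ← ℕₚ.m≤n⇒∃[o]m+o≡n 3+q≤hi = begin-strict
    weight (3 + q + d) q + weight (3 + q + d) (3 + q)        ≡⟨ cong₂ _+_ (weight-at q (3 + d) (shift₀ q d))
                                                                          (weight-at (3 + q) d refl) ⟩
    (5 + d) + (2 + d)                                        <⟨ ℕₚ.≤-reflexive (regroup d) ⟩
    (4 + d) + (4 + d)                                        ≡⟨ cong₂ _+_ (weight-at (1 + q) (2 + d) (shift₁ q d))
                                                                          (weight-at (1 + q) (2 + d) (shift₁ q d)) ⟨
    weight (3 + q + d) (1 + q) + weight (3 + q + d) (1 + q)  ∎
    where
    open ℕₚ.≤-Reasoning
    shift₀ : ∀ q d → 3 + q + d ≡ q + (3 + d)
    shift₀ = solve-∀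
    shift₁ : ∀ q d → 3 + q + d ≡ 1 + q + (2 + d)
    shift₁ = solve-∀
    regroup : ∀ d → suc ((5 + d) + (2 + d)) ≡ (4 + d) + (4 + d)
    regroup = solve-∀

  combine-reduction : ∀ {hi q ds} → Bounded hi ds → 1 + q ∈ ds → 2 + q ∈ remove (1 + q) ds →
                      Reduction hi ds (combineD q ds)
  combine-reduction {hi} {q} {ds} bnd a∈ b∈ = record
    { same-value = same-value
    ; dominates  = dominates
    ; bounded    = bounded
    ; smaller    = smaller
    }
    where
    rest = remove (2 + q) (remove (1 + q) ds)
    perm : ds ↭ 1 + q ∷ 2 + q ∷ rest
    perm = remove₂-↭ a∈ b∈
    r = length rest
    length≡ : length ds ≡ 2 + r
    length≡ = ↭-length perm
    rest⊆ : ∀ {y} → y ∈ rest → y ∈ ds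
    rest⊆ = ∈-remove⁻ ds ∘ ∈-remove⁻ (remove (1 + q) ds)
    2+q≤hi : 2 + q ≤ hi
    2+q≤hi = bnd (∈-remove⁻ ds b∈)

    same-value : value (combineD q ds) ≡ value ds
    same-value = begin
      negFib q ℤ.+ value rest                               ≡⟨ cong (ℤ._+ value rest) (negFib-rec q) ⟩
      negFib (1 + q) ℤ.+ negFib (2 + q) ℤ.+ value rest      ≡⟨ ℤₚ.+-assoc (negFib (1 + q)) _ _ ⟩
      negFib (1 + q) ℤ.+ (negFib (2 + q) ℤ.+ value rest)    ≡⟨ ∑-↭ negFib perm ⟨
      value ds                                              ∎
      where open ≡-Reasoning

    bounded : Bounded hi (combineD q ds)
    bounded (here refl) = ℕₚ.≤-trans (ℕₚ.m≤n+m q 2) 2+q≤hi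
    bounded (there y∈)  = bnd (rest⊆ y∈)

    smaller : potential hi (combineD q ds) < potential hi ds
    smaller = begin-strict
      weight hi q + potential hi rest                                  <⟨ ℕₚ.+-monoˡ-< _ (weight-combine q 2+q≤hi) ⟩
      weight hi (1 + q) + weight hi (2 + q) + potential hi rest        ≡⟨ ℕₚ.+-assoc (weight hi (1 + q)) _ _ ⟩
      weight hi (1 + q) + (weight hi (2 + q) + potential hi rest)      ≡⟨ sum-↭ (map⁺ (weight hi) perm) ⟨
      potential hi ds                                                  ∎
      where open ℕₚ.≤-Reasoning

    lose-one : ∀ {x y} → x ≤ y + 2 → x + 2 * suc r ≤ y + 2 * length ds
    lose-one {x} {y} x≤y+2 = begin
      x + 2 * suc r              ≤⟨ ℕₚ.+-monoˡ-≤ (2 * suc r) x≤y+2 ⟩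
      y + 2 + 2 * suc r          ≡⟨ regroup y r ⟩
      y + 2 * (2 + r)            ≡⟨ cong (λ l → y + 2 * l) length≡ ⟨
      y + 2 * length ds          ∎
      where
      open ℕₚ.≤-Reasoning
      regroup : ∀ y r → y + 2 + 2 * suc r ≡ y + 2 * (2 + r)
      regroup = solve-∀

    dominates : Dominates ds (combineD q ds)
    dominates {x} x∈ with x ℕₚ.≟ 1 + q | x ℕₚ.≟ 2 + q
    ... | yes refl | _        = q , here refl ,
                                lose-one (ℕₚ.≤-trans (ℕₚ.n≤1+n (1 + q)) (ℕₚ.≤-reflexive (ℕₚ.+-comm 2 q)))
    ... | no _     | yes refl = q , here refl , lose-one (ℕₚ.≤-reflexive (ℕₚ.+-comm 2 q))
    ... | no x≢a   | no x≢b   = x , there (∈-remove⁺ x≢b (∈-remove⁺ x≢a x∈)) , lose-one (ℕₚ.m≤m+n x 2)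

  split-reduction : ∀ {hi q ds} → Bounded hi ds → 3 + q ≤ hi → 1 + q ∈ ds → 1 + q ∈ remove (1 + q) ds →
                    Reduction hi ds (splitD q ds)
  split-reduction {hi} {q} {ds} bnd 3+q≤hi a∈ a∈′ = record
    { same-value = same-value
    ; dominates  = dominates
    ; bounded    = bounded
    ; smaller    = smaller
    }
    where
    rest = remove (1 + q) (remove (1 + q) ds)
    perm : ds ↭ 1 + q ∷ 1 + q ∷ rest
    perm = remove₂-↭ a∈ a∈′
    r = length rest
    length≡ : length ds ≡ 2 + r
    length≡ = ↭-length perm

    same-value : value (splitD q ds) ≡ value ds
    same-value = begin
      negFib q ℤ.+ (negFib (3 + q) ℤ.+ value rest)          ≡⟨ ℤₚ.+-assoc (negFib q) _ _ ⟨
      negFib q ℤ.+ negFib (3 + q) ℤ.+ value rest            ≡⟨ cong (ℤ._+ value rest) (negFib-split q) ⟨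
      negFib (1 + q) ℤ.+ negFib (1 + q) ℤ.+ value rest      ≡⟨ ℤₚ.+-assoc (negFib (1 + q)) _ _ ⟩
      negFib (1 + q) ℤ.+ (negFib (1 + q) ℤ.+ value rest)    ≡⟨ ∑-↭ negFib perm ⟨
      value ds                                              ∎
      where open ≡-Reasoning

    bounded : Bounded hi (splitD q ds)
    bounded (here refl)         = ℕₚ.≤-trans (ℕₚ.m≤n+m q 3) 3+q≤hi
    bounded (there (here refl)) = 3+q≤hi
    bounded (there (there y∈))  = bnd (∈-remove⁻ ds (∈-remove⁻ (remove (1 + q) ds) y∈))

    smaller : potential hi (splitD q ds) < potential hi ds
    smaller = begin-strict
      weight hi q + (weight hi (3 + q) + potential hi rest)            ≡⟨ ℕₚ.+-assoc (weight hi q) _ _ ⟨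
      weight hi q + weight hi (3 + q) + potential hi rest              <⟨ ℕₚ.+-monoˡ-< _ (weight-split q 3+q≤hi) ⟩
      weight hi (1 + q) + weight hi (1 + q) + potential hi rest        ≡⟨ ℕₚ.+-assoc (weight hi (1 + q)) _ _ ⟩
      weight hi (1 + q) + (weight hi (1 + q) + potential hi rest)      ≡⟨ sum-↭ (map⁺ (weight hi) perm) ⟨
      potential hi ds                                                  ∎
      where open ℕₚ.≤-Reasoning

    keep : ∀ {x y} → x ≤ y → x + 2 * (2 + r) ≤ y + 2 * length ds
    keep {x} {y} x≤y = ℕₚ.+-mono-≤ x≤y (ℕₚ.≤-reflexive (cong (2 *_) (sym length≡)))

    dominates : Dominates ds (splitD q ds)
    dominates {x} x∈ with x ℕₚ.≟ 1 + q
    ... | yes refl = 3 + q , there (here refl) , keep (ℕₚ.+-monoˡ-≤ q {1} {3} (s≤s z≤n))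
    ... | no x≢a   = x , there (there (∈-remove⁺ x≢a (∈-remove⁺ x≢a x∈))) , keep ℕₚ.≤-refl

  Adjacent : List ℕ → ℕ → Set
  Adjacent ds y = 0 < y × suc y ∈ ds

  Splittable : ℕ → List ℕ → ℕ → Set
  Splittable hi ds y = 0 < y × 2 + y ≤ hi × 2 ≤ count y ds

  Terminal : ℕ → List ℕ → Set
  Terminal hi ds = (∀ {y} → y ∈ ds → ¬ Adjacent ds y) × (∀ {y} → y ∈ ds → ¬ Splittable hi ds y)

  +≤⇒≤∣∣ : ∀ {m s} → ℤ.+ m ℤ.≤ s → m ≤ ∣ s ∣
  +≤⇒≤∣∣ (ℤ.+≤+ m≤n) = m≤n

  highest : ∀ y ys → ∃[ R ] R ∈ y ∷ ys × Bounded R (y ∷ ys)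
  highest = least {_≼_ = λ a b → b ≤ a} (λ a b → ℕₚ.≤-total b a) (λ b≤a c≤b → ℕₚ.≤-trans c≤b b≤a)

  terminal-bound-at : ∀ {hi ds R} → Bounded hi ds →
                      Terminal hi ds → R ∈ ds → Bounded R ds → 2 ≤ length ds → ValueBound ds
  terminal-bound-at {hi} {ds} {R} bnd (no-adj , no-spl) R∈ below-R 2≤len {x} x∈ k k≤ = begin
      fib k                            ≤⟨ fib-mono (ℕₚ.≤-trans (ℕₚ.m+n≤o⇒m≤o∸n k k+2≤R) (ℕₚ.n≤1+n j)) ⟩
      fib (1 + j)                      ≤⟨ +≤⇒≤∣∣ (σ-top c j top gap binary) ⟩
      ∣ σ c (2 + j) ∣                  ≡⟨ ∣σ-digits∣ (2 + j) ds (subst (λ R → Bounded R ds) R≡2+j below-R) ⟩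
      ∣ value ds ∣                     ∎
    where
    open ℕₚ.≤-Reasoning
    k+2≤R : k + 2 ≤ R
    k+2≤R = ℕₚ.+-cancelʳ-≤ 2 _ _ (begin
      k + 2 + 2                        ≡⟨ ℕₚ.+-assoc k 2 2 ⟩
      k + 2 * 2                        ≤⟨ ℕₚ.+-monoʳ-≤ k (ℕₚ.*-monoʳ-≤ 2 2≤len) ⟩
      k + 2 * length ds                ≤⟨ k≤ ⟩
      x + 2                            ≤⟨ ℕₚ.+-monoˡ-≤ 2 (below-R x∈) ⟩
      R + 2                            ∎)
    j = R ∸ 2
    R≡2+j : R ≡ 2 + j
    R≡2+j = sym (ℕₚ.m+[n∸m]≡n (ℕₚ.m+n≤o⇒n≤o k k+2≤R))
    c = digits ds
    2+j∈ : 2 + j ∈ ds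
    2+j∈ = subst (_∈ ds) R≡2+j R∈
    top : 1 ≤ c (2 + j)
    top = ∈⇒count-pos 2+j∈
    gap : c (1 + j) ≡ 0
    gap with c (1 + j) in c≡
    ... | zero  = refl
    ... | suc _ = ⊥-elim (no-adj (count-pos⇒∈ ds (subst (0 <_) (sym c≡) (s≤s z≤n))) (s≤s z≤n , 2+j∈))
    binary : Binary j c
    binary {r} 0<r r≤j with 2 ℕₚ.≤? c r
    ... | yes 2≤c = ⊥-elim (no-spl (count-pos⇒∈ ds (ℕₚ.≤-trans (s≤s z≤n) 2≤c))
                                   (0<r , ℕₚ.≤-trans (ℕₚ.+-monoʳ-≤ 2 r≤j) (subst (_≤ hi) R≡2+j (bnd R∈)) , 2≤c))
    ... | no 2≰c  = ℕₚ.≤-pred (ℕₚ.≰⇒> 2≰c)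

  terminal-bound : ∀ {hi ds} → Bounded hi ds → Terminal hi ds → ValueBound ds
  terminal-bound {ds = y ∷ []} _ _ (here refl) k k+2≤y+2 = begin
    fib k                    ≤⟨ fib-mono (ℕₚ.+-cancelʳ-≤ 2 k y k+2≤y+2) ⟩
    fib y                    ≡⟨ ∣negFib∣ y ⟨
    ∣ negFib y ∣             ≡⟨ cong ∣_∣ (ℤₚ.+-identityʳ (negFib y)) ⟨
    ∣ negFib y ℤ.+ 0ℤ ∣      ∎
    where open ℕₚ.≤-Reasoning
  terminal-bound {ds = y ∷ z ∷ zs} bnd terminal with highest y (z ∷ zs)
  ... | R , R∈ , below-R = terminal-bound-at bnd terminal R∈ below-R (s≤s (s≤s z≤n))

  adjacent? : ∀ ds → Decidable (Adjacent ds)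
  adjacent? ds y = (0 ℕₚ.<? y) ×-dec (suc y ∈? ds)

  splittable? : ∀ hi ds → Decidable (Splittable hi ds)
  splittable? hi ds y = (0 ℕₚ.<? y) ×-dec (2 + y ℕₚ.≤? hi) ×-dec (2 ℕₚ.≤? count y ds)

  reduction-or-terminal : ∀ hi ds → Bounded hi ds → (∃[ ds′ ] Reduction hi ds ds′) ⊎ Terminal hi ds
  reduction-or-terminal hi ds bnd with any? (adjacent? ds) ds
  ... | yes adj with find adj
  ...   | suc q , 1+q∈ , _ , 2+q∈ = inj₁ (_ , combine-reduction bnd 1+q∈ (∈-remove⁺ ℕₚ.1+n≢n 2+q∈))
  reduction-or-terminal hi ds bnd | no no-adj with any? (splittable? hi ds) ds
  ... | yes spl with find spl
  ...   | suc q , _ , _ , 3+q≤hi , 2≤count = inj₁ (_ , split-reduction bnd 3+q≤hi 1+q∈ 1+q∈′)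
    where
    1+q∈ : 1 + q ∈ ds
    1+q∈ = count-pos⇒∈ ds (ℕₚ.≤-trans (s≤s z≤n) 2≤count)
    1+q∈′ : 1 + q ∈ remove (1 + q) ds
    1+q∈′ = count-pos⇒∈ (remove (1 + q) ds)
              (subst (0 <_) (sym (count-remove-≡ (1 + q) ds)) (ℕₚ.∸-monoˡ-≤ 1 2≤count))
  reduction-or-terminal hi ds bnd | no no-adj | no no-spl =
    inj₂ ((λ y∈ adj → no-adj (lose y∈ adj)) , (λ y∈ spl → no-spl (lose y∈ spl)))

  value-bound-below : ∀ hi ds → Bounded hi ds → Acc _<_ (potential hi ds) → ValueBound ds
  value-bound-below hi ds bnd (acc smaller-bound) with reduction-or-terminal hi ds bnd
  ... | inj₁ (ds′ , red) = transfer same-value dominates (value-bound-below hi ds′ bounded (smaller-bound smaller))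
    where open Reduction red
  ... | inj₂ terminal = terminal-bound bnd terminal

  value-bound : ∀ ds → ValueBound ds
  value-bound []       ()
  value-bound (y ∷ ys) with highest y ys
  ... | hi , _ , bnd = value-bound-below hi (y ∷ ys) bnd (<-wellFounded _)

module Reflection where

  open Fibonacci
  open IntegerFibonacci
  open ChipLists
  private module D = Depths
  open import Data.Nat.Base as ℕ using (ℕ; suc)
  import Data.Nat.Properties as ℕₚ
  open import Data.Integer.Base using (ℤ; +_; -_; _+_; _-_; _≤_; ∣_∣)
  import Data.Integer.Properties as ℤₚ
  open import Data.List.Base using (List; []; _∷_; map)
  open import Data.List.Membership.Propositional using (_∈_)
  open import Data.List.Relation.Unary.Any using (here; there)
  open import Relation.Nullary using (Dec; yes; no)
  open import Relation.Binary.PropositionalEquality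
  open import Function using (_∘_)
  open import Data.Integer.Tactic.RingSolver using (solve-∀)

  Below : ℕ → List ℤ → Set
  Below K ℓ = ∀ {p} → p ∈ ℓ → p ≤ + K

  depth : ℕ → ℤ → ℕ
  depth K p = ∣ + K - p ∣

  depths : ℕ → List ℤ → List ℕ
  depths K = map (depth K)

  +depth : ∀ {K p} → p ≤ + K → + depth K p ≡ + K - p
  +depth p≤K = ℤₚ.0≤i⇒+∣i∣≡i (ℤₚ.i≤j⇒0≤j-i p≤K)

  depth-inverse : ∀ K r → depth K (+ K - + r) ≡ r
  depth-inverse K r = cong ∣_∣ (cancel (+ K) (+ r))
    where
    cancel : ∀ k r → k - (k - r) ≡ r
    cancel = solve-∀

  negFib-depth : ∀ {K p} → p ≤ + K → negFib (depth K p) ≡ fibℤ (- + K + p)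
  negFib-depth {K} {p} p≤K = trans (cong (fibℤ ∘ -_) (+depth p≤K)) (cong fibℤ (negate (+ K) p))
    where
    negate : ∀ k p → - (k - p) ≡ - k + p
    negate = solve-∀

  value-depths : ∀ K ℓ → Below K ℓ → D.value (depths K ℓ) ≡ ∑ (λ p → fibℤ (- + K + p)) ℓ
  value-depths K []       _     = refl
  value-depths K (p ∷ ℓ) below = cong₂ _+_ (negFib-depth (below (here refl))) (value-depths K ℓ (below ∘ there))

  count-depths : ∀ K ℓ → Below K ℓ → ∀ r → D.count r (depths K ℓ) ≡ count (+ K - + r) ℓ
  count-depths K []       _     r = refl
  count-depths K (p ∷ ℓ) below r = by-cases (r ℕₚ.≟ depth K p)
    where
    open ≡-Reasoning
    ih = count-depths K ℓ (below ∘ there) r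
    by-cases : Dec (r ≡ depth K p) → D.count r (depths K (p ∷ ℓ)) ≡ count (+ K - + r) (p ∷ ℓ)
    by-cases (yes r≡depth) = begin
      D.count r (depths K (p ∷ ℓ))    ≡⟨ D.count-∷-≡ (depths K ℓ) r≡depth ⟩
      suc (D.count r (depths K ℓ))    ≡⟨ cong suc ih ⟩
      suc (count (+ K - + r) ℓ)       ≡⟨ count-∷-≡ ℓ K-r≡p ⟨
      count (+ K - + r) (p ∷ ℓ)       ∎
      where
      K-r≡p : + K - + r ≡ p
      K-r≡p = begin
        + K - + r                ≡⟨ cong (λ d → + K - + d) r≡depth ⟩
        + K - + depth K p        ≡⟨ cong (_-_ (+ K)) (+depth (below (here refl))) ⟩
        + K - (+ K - p)          ≡⟨ cancel (+ K) p ⟩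
        p                        ∎
        where
        cancel : ∀ k p → k - (k - p) ≡ p
        cancel = solve-∀
    by-cases (no r≢depth) = begin
      D.count r (depths K (p ∷ ℓ))    ≡⟨ D.count-∷-≢ (depths K ℓ) r≢depth ⟩
      D.count r (depths K ℓ)          ≡⟨ ih ⟩
      count (+ K - + r) ℓ             ≡⟨ count-∷-≢ ℓ (r≢depth ∘ trans (sym (depth-inverse K r)) ∘ cong (depth K)) ⟨
      count (+ K - + r) (p ∷ ℓ)       ∎

module UpperBound where

  open Fibonacci
  open IntegerFibonacci
  open ChipLists
  open Reflection
  private module D = Depths
  open import Data.Nat.Base as ℕ using (ℕ; suc; >-nonZero)
  import Data.Nat.Properties as ℕₚ
  open import Data.Integer.Base as ℤ using (ℤ; +_; -[1+_]; -_; _+_; _-_; _*_; _≤_; ∣_∣; -≤+)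
  import Data.Integer.Properties as ℤₚ
  open import Data.List.Base using ([]; _∷_; length)
  open import Data.List.Properties using (length-map)
  open import Data.List.Membership.Propositional using (_∈_)
  open import Data.List.Membership.Propositional.Properties using (∈-map⁺)
  open import Data.Product using (∃-syntax; _×_; _,_)
  open import Relation.Binary.PropositionalEquality
  open import Data.Integer.Tactic.RingSolver using (solve-∀)
  import Data.Nat.Tactic.RingSolver as ℕ-Solver
  open Extremes using (least)

  highest : ∀ p ℓ → ∃[ t ] t ∈ p ∷ ℓ × (∀ {q} → q ∈ p ∷ ℓ → q ≤ t)
  highest = least {_≼_ = λ a b → b ≤ a} (λ a b → ℤₚ.≤-total b a) (λ b≤a c≤b → ℤₚ.≤-trans c≤b b≤a)

  lowest : ∀ p ℓ → ∃[ i ] i ∈ p ∷ ℓ × (∀ {q} → q ∈ p ∷ ℓ → i ≤ q)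
  lowest = least ℤₚ.≤-total ℤₚ.≤-trans

  i≤+∣i∣ : ∀ i → i ≤ + ∣ i ∣
  i≤+∣i∣ (+ _)    = ℤₚ.≤-refl
  i≤+∣i∣ -[1+ _ ] = -≤+

  bound-above : ∀ ℓ → ∃[ K ] Below K ℓ
  bound-above []      = 0 , λ ()
  bound-above (p ∷ ℓ) with highest p ℓ
  ... | t , _ , ≤t = ∣ t ∣ , λ q∈ → ℤₚ.≤-trans (≤t q∈) (i≤+∣i∣ t)

  ∣value-depths∣ : ∀ {n ℓ} K → Balanced n ℓ → Below K ℓ → ∣ D.value (depths K ℓ) ∣ ≡ n ℕ.* fib K
  ∣value-depths∣ {n} {ℓ} K bal below = begin
    ∣ D.value (depths K ℓ) ∣                     ≡⟨ cong ∣_∣ (trans (value-depths K ℓ below) (bal (- + K))) ⟩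
    ∣ + n * negFib K ∣                           ≡⟨ ℤₚ.∣i*j∣≡∣i∣*∣j∣ (+ n) (negFib K) ⟩
    n ℕ.* ∣ negFib K ∣                           ≡⟨ cong (n ℕ.*_) (∣negFib∣ K) ⟩
    n ℕ.* fib K                                  ∎
    where open ≡-Reasoning

  chip-bound : ∀ {n ℓ} → Balanced n ℓ → length ℓ ℕ.≤ n →
               ∀ k → - + (2 ℕ.* n ℕ.+ 2 ℕ.+ k) ∈ ℓ → fib (2 ℕ.+ k) ℕ.≤ n
  chip-bound {n} {ℓ} bal len k i∈ with K₀ , below₀ ← bound-above ℓ =
    ℕₚ.*-cancelˡ-≤ (fib K) {{>-nonZero (1≤fib[1+n] K₀)}} (begin
      fib K ℕ.* fib (2 ℕ.+ k)     ≤⟨ fib*fib≤fib K₀ (suc k) ⟩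
      fib k′                      ≤⟨ D.value-bound (depths K ℓ) (∈-map⁺ (depth K) i∈) k′ k′-fits ⟩
      ∣ D.value (depths K ℓ) ∣    ≡⟨ ∣value-depths∣ {n} K bal below ⟩
      n ℕ.* fib K                 ≡⟨ ℕₚ.*-comm n (fib K) ⟩
      fib K ℕ.* n                 ∎)
    where
    open ℕₚ.≤-Reasoning
    K = suc K₀
    below : Below K ℓ
    below p∈ = ℤₚ.≤-trans (below₀ p∈) (ℤ.+≤+ (ℕₚ.n≤1+n K₀))
    d = 2 ℕ.* n ℕ.+ 2 ℕ.+ k
    k′ = suc (K₀ ℕ.+ suc k)
    depth≡ : depth K (- + d) ≡ K ℕ.+ d
    depth≡ = cong ∣_∣ (cong (_+_ (+ K)) (ℤₚ.neg-involutive (+ d)))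
    k′-fits : k′ ℕ.+ 2 ℕ.* length (depths K ℓ) ℕ.≤ depth K (- + d) ℕ.+ 2
    k′-fits = begin
      k′ ℕ.+ 2 ℕ.* length (depths K ℓ)   ≡⟨ cong (λ m → k′ ℕ.+ 2 ℕ.* m) (length-map (depth K) ℓ) ⟩
      k′ ℕ.+ 2 ℕ.* length ℓ              ≤⟨ ℕₚ.+-monoʳ-≤ k′ (ℕₚ.*-monoʳ-≤ 2 len) ⟩
      k′ ℕ.+ 2 ℕ.* n                     ≤⟨ ℕₚ.m≤m+n _ 3 ⟩
      k′ ℕ.+ 2 ℕ.* n ℕ.+ 3               ≡⟨ regroup K₀ k (2 ℕ.* n) ⟩
      K ℕ.+ d ℕ.+ 2                      ≡⟨ cong (ℕ._+ 2) depth≡ ⟨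
      depth K (- + d) ℕ.+ 2              ∎
      where
      regroup : ∀ K₀ k m → suc (K₀ ℕ.+ suc k) ℕ.+ m ℕ.+ 3 ≡ suc K₀ ℕ.+ (m ℕ.+ 2 ℕ.+ k) ℕ.+ 2
      regroup = ℕ-Solver.solve-∀

  upper-bound : ∀ {n T} → Reachable (start n) T → ∀ {i} → IsLeftmost T i → ≤LogPhi (- i - + 2 * + n - + 2) 1 n
  upper-bound {n} moves {i} (0<Tᵢ , _) with ℓ , T≗ , bal , len ← chips-of-reachable moves =
    ≤LogPhi-fib _ 1 n λ k eq →
      ℕₚ.≤-trans (chip-bound bal len k (subst (_∈ ℓ) (i≡ k eq) i∈)) (ℕₚ.≤-reflexive (sym (ℕₚ.*-identityʳ n)))
    where
    i∈ : i ∈ ℓ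
    i∈ = count-pos⇒∈ ℓ (subst (0 ℕ.<_) (T≗ i) 0<Tᵢ)
    i≡ : ∀ k → - i - + 2 * + n - + 2 ≡ + k → i ≡ - + (2 ℕ.* n ℕ.+ 2 ℕ.+ k)
    i≡ k eq = begin
      i                                                ≡⟨ solve-i i (+ 2 * + n) ⟩
      - ((- i - + 2 * + n - + 2) + (+ 2 * + n + + 2))  ≡⟨ cong (λ z → - (z + (+ 2 * + n + + 2))) eq ⟩
      - (+ k + (+ 2 * + n + + 2))                      ≡⟨ cong -_ (lift k) ⟨
      - + (2 ℕ.* n ℕ.+ 2 ℕ.+ k)                        ∎
      where
      open ≡-Reasoning
      solve-i : ∀ i m → i ≡ - ((- i - m - + 2) + (m + + 2))
      solve-i = solve-∀
      lift : ∀ k → + (2 ℕ.* n ℕ.+ 2 ℕ.+ k) ≡ + k + (+ 2 * + n + + 2)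
      lift k = begin
        + (2 ℕ.* n ℕ.+ 2 ℕ.+ k)         ≡⟨ ℤₚ.pos-+ (2 ℕ.* n ℕ.+ 2) k ⟩
        + (2 ℕ.* n ℕ.+ 2) + + k         ≡⟨ cong (λ m → m + + 2 + + k) (ℤₚ.pos-* 2 n) ⟩
        + 2 * + n + + 2 + + k           ≡⟨ ℤₚ.+-comm (+ 2 * + n + + 2) (+ k) ⟩
        + k + (+ 2 * + n + + 2)         ∎

module Settling where

  open Fibonacci
  open IntegerFibonacci
  open ChipLists
  open UpperBound using (chip-bound)
  open import Data.Nat.Base as ℕ using (ℕ; zero; suc; z≤n; s≤s)
  import Data.Nat.Properties as ℕₚ
  open import Data.Integer.Base as ℤ using (ℤ; +_; -[1+_]; 0ℤ; -_; _+_; _-_; _≤_; -≤-)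
  import Data.Integer.Properties as ℤₚ
  open import Data.List.Base using (List; length; replicate)
  open import Data.List.Membership.Propositional using (_∈_; find; lose)
  open import Data.List.Relation.Unary.Any using (any?)
  open import Data.Product using (∃-syntax; _×_; _,_)
  open import Relation.Nullary using (yes; no; contradiction)
  open import Relation.Binary.PropositionalEquality
  open import Relation.Binary.Construct.Closure.ReflexiveTransitive using (Star; ε; _◅_)
  open import Data.Integer.Tactic.RingSolver using (solve-∀)
  import Data.Nat.Tactic.RingSolver as ℕ-Solver

  deep-offset : ∀ n {m} → 1 ℕ.+ 3 ℕ.* n ℕ.< m → ∃[ k ] suc m ≡ 2 ℕ.* n ℕ.+ 2 ℕ.+ k × n ℕ.< k
  deep-offset n {m} 1+3n<m = witness (ℕₚ.m≤n⇒∃[o]m+o≡n (ℕₚ.≤-trans (ℕₚ.m≤m+n _ (suc n)) 3+3n≤1+m))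
    where
    regroup : ∀ n → 2 ℕ.* n ℕ.+ 2 ℕ.+ suc n ≡ 3 ℕ.+ 3 ℕ.* n
    regroup = ℕ-Solver.solve-∀
    3+3n≤1+m : 2 ℕ.* n ℕ.+ 2 ℕ.+ suc n ℕ.≤ suc m
    3+3n≤1+m = ℕₚ.≤-trans (ℕₚ.≤-reflexive (regroup n)) (s≤s 1+3n<m)
    witness : ∃[ k ] 2 ℕ.* n ℕ.+ 2 ℕ.+ k ≡ suc m → ∃[ k ] suc m ≡ 2 ℕ.* n ℕ.+ 2 ℕ.+ k × n ℕ.< k
    witness (k , 2n+2+k≡1+m) = k , sym 2n+2+k≡1+m ,
      ℕₚ.+-cancelˡ-≤ (2 ℕ.* n ℕ.+ 2) _ _ (ℕₚ.≤-trans 3+3n≤1+m (ℕₚ.≤-reflexive (sym 2n+2+k≡1+m)))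

  chips-above : ∀ {n ℓ} → Balanced n ℓ → length ℓ ℕ.≤ n → ∀ {p} → p ∈ ℓ → - + (2 ℕ.+ 3 ℕ.* n) ≤ p
  chips-above         bal len {+ _}    _  = ℤₚ.neg-≤-pos
  chips-above {n} {ℓ} bal len { -[1+ m ]} p∈ with m ℕₚ.≤? 1 ℕ.+ 3 ℕ.* n
  ... | yes m≤ = -≤- m≤
  ... | no m≰ with k , 1+m≡ , n<k ← deep-offset n (ℕₚ.≰⇒> m≰) =
    contradiction (chip-bound bal len k (subst (_∈ ℓ) (cong (λ d → - + d) 1+m≡) p∈))
                  (ℕₚ.<⇒≱ (ℕₚ.<-≤-trans n<k (ℕₚ.≤-trans (n≤fib[1+n] k) (fib[n]≤fib[1+n] (suc k)))))

  excess : ℕ → List ℤ → ℤ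
  excess n = ∑ (λ p → p + + (2 ℕ.+ 3 ℕ.* n))

  excess-nonneg : ∀ {n ℓ} → Balanced n ℓ → length ℓ ℕ.≤ n → 0ℤ ≤ excess n ℓ
  excess-nonneg {n} {ℓ} bal len = ∑-nonneg _ ℓ λ {p} p∈ →
    subst (0ℤ ≤_) (cong (_+_ p) (ℤₚ.neg-involutive (+ (2 ℕ.+ 3 ℕ.* n))))
          (ℤₚ.i≤j⇒0≤j-i (chips-above bal len p∈))

  excess-split : ∀ {n ℓ i} → i ∈ ℓ → i ∈ remove i ℓ → excess n (splitL i ℓ) + + 1 ≡ excess n ℓ
  excess-split {n} {ℓ} {i} i∈ i∈′ = begin
    (i - + 2 + B) + ((i + + 1 + B) + ∑ f rest) + + 1   ≡⟨ regroup i B (∑ f rest) ⟩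
    (i + B) + ((i + B) + ∑ f rest)                    ≡⟨ ∑-↭ f (remove₂-↭ i∈ i∈′) ⟨
    excess n ℓ                                        ∎
    where
    open ≡-Reasoning
    B = + (2 ℕ.+ 3 ℕ.* n)
    f = λ p → p + B
    rest = remove i (remove i ℓ)
    regroup : ∀ i B s → (i - + 2 + B) + ((i + + 1 + B) + s) + + 1 ≡ (i + B) + ((i + B) + s)
    regroup = solve-∀

  excess-start : ∀ n m → excess n (replicate m 0ℤ) ≡ + (m ℕ.* (2 ℕ.+ 3 ℕ.* n))
  excess-start n zero    = refl
  excess-start n (suc m) = cong (_+_ (+ (2 ℕ.+ 3 ℕ.* n))) (excess-start n m)

  record DistinctReach (n : ℕ) (a : State) : Set where
    field
      {final}  : State
      chips    : List ℤ
      moves    : Star Move a final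
      tallies  : final ≗ tally chips
      balanced : Balanced n chips
      size     : length chips ≡ n
      distinct : ∀ q → count q chips ℕ.≤ 1

  prepend : ∀ {n a b} → Move a b → DistinctReach n b → DistinctReach n a
  prepend move r = record
    { chips = chips ; moves = move ◅ moves ; tallies = tallies ; balanced = balanced ; size = size ; distinct = distinct }
    where open DistinctReach r

  settle : ∀ {n} fuel {a} ℓ → a ≗ tally ℓ → Balanced n ℓ → length ℓ ≡ n → excess n ℓ ≡ + fuel →
           DistinctReach n a
  settle {n} fuel {a} ℓ a≗ bal len exc with any? (λ q → 2 ℕₚ.≤? count q ℓ) ℓ
  ... | no no-dup = record
    { chips = ℓ ; moves = ε ; tallies = a≗ ; balanced = bal ; size = len ; distinct = distinct }
    where
    distinct : ∀ q → count q ℓ ℕ.≤ 1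
    distinct q with 2 ℕₚ.≤? count q ℓ
    ... | yes 2≤count = contradiction (lose (count-pos⇒∈ ℓ (ℕₚ.≤-trans (s≤s z≤n) 2≤count)) 2≤count) no-dup
    ... | no 2≰count  = ℕₚ.≤-pred (ℕₚ.≰⇒> 2≰count)
  ... | yes dup with find dup
  ...   | p , _ , 2≤count = split-at p (subst (2 ℕ.≤_) (sym (a≗ p)) 2≤count)
    where
    split-at : ∀ p → 2 ℕ.≤ a p → DistinctReach n a
    split-at p 2≤aₚ with split-chips {ℓ = ℓ} a≗ 2≤aₚ
    ... | p∈ , p∈′ = continue fuel (trans (excess-split {n} p∈ p∈′) exc)
      where
      ℓ′ = splitL p ℓ
      bal′ = balanced-split {n} p∈ p∈′ bal
      len′ = trans (length-split p∈ p∈′) len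
      continue : ∀ fuel → excess n ℓ′ + + 1 ≡ + fuel → DistinctReach n a
      continue zero    exc′ = contradiction (subst (+ 1 ≤_) exc′ 1≤excess+1) λ { (ℤ.+≤+ ()) }
        where
        1≤excess+1 = ℤₚ.+-monoˡ-≤ (+ 1) (excess-nonneg {n} {ℓ′} bal′ (ℕₚ.≤-reflexive len′))
      continue (suc f) exc′ =
        prepend (split p 2≤aₚ) (settle f ℓ′ (tally-split {ℓ = ℓ} p a≗) bal′ len′ (unshift exc′))
        where
        open ≡-Reasoning
        add-sub : ∀ x → x ≡ x + + 1 - + 1
        add-sub = solve-∀
        add-sub′ : ∀ x → + 1 + x - + 1 ≡ x
        add-sub′ = solve-∀
        unshift : excess n ℓ′ + + 1 ≡ + suc f → excess n ℓ′ ≡ + f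
        unshift e = begin
          excess n ℓ′                   ≡⟨ add-sub (excess n ℓ′) ⟩
          excess n ℓ′ + + 1 - + 1       ≡⟨ cong (_- + 1) e ⟩
          + 1 + + f - + 1               ≡⟨ add-sub′ (+ f) ⟩
          + f                           ∎

module LowerBound where

  open Fibonacci
  open IntegerFibonacci
  open Digits
  open ChipLists
  open Reflection
  open UpperBound using (highest; lowest; i≤+∣i∣; ∣value-depths∣)
  open Settling
  private module D = Depths
  open import Data.Nat.Base as ℕ using (ℕ; zero; suc; _^_; z≤n; s≤s; >-nonZero)
  import Data.Nat.Properties as ℕₚ
  open import Data.Integer.Base as ℤ using (ℤ; +_; -[1+_]; 0ℤ; -_; _+_; _-_; _*_; _≤_; ∣_∣; -≤+; +≤+)
  import Data.Integer.Properties as ℤₚ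
  open import Data.List.Base using ([]; _∷_; length; replicate)
  open import Data.List.Properties using (length-map; length-replicate)
  open import Data.List.Membership.Propositional using (_∈_)
  open import Data.List.Membership.Propositional.Properties using (∈-map⁺; ∈-map⁻)
  open import Data.Product using (Σ; ∃-syntax; _×_; _,_)
  open import Relation.Nullary using (yes; no; contradiction)
  open import Relation.Binary.PropositionalEquality hiding (J)
  open import Data.Integer.Tactic.RingSolver using (solve-∀)
  import Data.Nat.Tactic.RingSolver as ℕ-Solver

  fibℤ-nonneg : ∀ {x} → 0ℤ ≤ x → 0ℤ ≤ fibℤ x
  fibℤ-nonneg (+≤+ _) = +≤+ z≤n

  0≤+∣i∣+i : ∀ i → 0ℤ ≤ + ∣ i ∣ + i
  0≤+∣i∣+i (+ m)      = +≤+ z≤n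
  0≤+∣i∣+i -[1+ m ]   = ℤₚ.≤-reflexive (sym (ℤₚ.+-inverseʳ (+ suc m)))

  top-bound : ∀ {n ℓ i} → Balanced n ℓ → (∀ {q} → q ∈ ℓ → i ≤ q) → ∀ {k} → + k ∈ ℓ → fib (suc k) ℕ.≤ n
  top-bound {n} {ℓ} {i} bal i≤ {k} k∈ =
    ℕₚ.*-cancelˡ-≤ (fib J) {{>-nonZero (1≤fib[1+n] ∣ i ∣)}} (begin
      fib J ℕ.* fib (suc k)    ≤⟨ fib*fib≤fib ∣ i ∣ k ⟩
      fib (J ℕ.+ k)            ≤⟨ ℤₚ.drop‿+≤+ (ℤₚ.≤-trans (term≤∑ (λ p → fibℤ (+ J + p)) nonneg k∈)
                                                           (ℤₚ.≤-reflexive (trans (bal (+ J)) (sym (ℤₚ.pos-* n (fib J)))))) ⟩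
      n ℕ.* fib J              ≡⟨ ℕₚ.*-comm n (fib J) ⟩
      fib J ℕ.* n              ∎)
    where
    open ℕₚ.≤-Reasoning
    J = suc ∣ i ∣
    nonneg : ∀ {q} → q ∈ ℓ → 0ℤ ≤ fibℤ (+ J + q)
    nonneg q∈ = fibℤ-nonneg (ℤₚ.≤-trans (0≤+∣i∣+i i) (ℤₚ.+-mono-≤ (+≤+ (ℕₚ.n≤1+n ∣ i ∣)) (i≤ q∈)))

  depth-antitone : ∀ {K p q} → p ≤ q → q ≤ + K → depth K q ℕ.≤ depth K p
  depth-antitone {K} {p} {q} p≤q q≤K =
    ℤₚ.drop‿+≤+ (subst₂ _≤_ (sym (+depth q≤K)) (sym (+depth (ℤₚ.≤-trans p≤q q≤K)))
                          (ℤₚ.+-monoʳ-≤ (+ K) (ℤₚ.neg-mono-≤ p≤q)))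

  spread : ∀ {n ℓ K i L} → Balanced n ℓ → length ℓ ≡ n → (∀ q → count q ℓ ℕ.≤ 1) →
           Below K ℓ → fib K ℕ.≤ n → i ∈ ℓ → (∀ {q} → q ∈ ℓ → i ≤ q) → n ℕ.* n ℕ.< fib L →
           2 ℕ.* n ℕ.≤ depth K i ℕ.+ L ℕ.+ 3
  spread {n} {ℓ} {K} {i} {L} bal len distinct below F≤n i∈ i≤ n²<F =
    subst (λ t → 2 ℕ.* t ℕ.≤ R ℕ.+ L ℕ.+ 3) total≡n (sparse-top c R n²<F binary top σ≤n²)
    where
    ds = depths K ℓ
    R = depth K i
    c = D.digits ds
    binary : ∀ r → c r ℕ.≤ 1
    binary r = subst (ℕ._≤ 1) (sym (count-depths K ℓ below r)) (distinct (+ K - + r))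
    top : c R ≡ 1
    top = ℕₚ.≤-antisym (binary R) (D.∈⇒count-pos (∈-map⁺ (depth K) i∈))
    bounded : D.Bounded R ds
    bounded r∈ with ∈-map⁻ (depth K) r∈
    ... | q , q∈ , refl = depth-antitone (i≤ q∈) (below q∈)
    total≡n : total c R ≡ n
    total≡n = trans (D.total-digits R ds bounded) (trans (length-map (depth K) ℓ) len)
    σ≤n² : σ c R ≤ + (n ℕ.* n)
    σ≤n² = begin
      σ c R                    ≤⟨ i≤+∣i∣ (σ c R) ⟩
      + ∣ σ c R ∣              ≡⟨ cong +_ (trans (D.∣σ-digits∣ R ds bounded) (∣value-depths∣ {n} K bal below)) ⟩
      + (n ℕ.* fib K)          ≤⟨ +≤+ (ℕₚ.*-monoʳ-≤ n F≤n) ⟩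
      + (n ℕ.* n)              ∎
      where open ℤₚ.≤-Reasoning

  fib-bracket : ∀ B → ∃[ L ] fib L ℕ.≤ B × B ℕ.< fib (suc L)
  fib-bracket B = descend (suc B) (n≤fib[1+n] (suc B))
    where
    descend : ∀ L → B ℕ.< fib (suc L) → ∃[ L ] fib L ℕ.≤ B × B ℕ.< fib (suc L)
    descend zero    B<F = 0 , z≤n , B<F
    descend (suc L) B<F with fib (suc L) ℕₚ.≤? B
    ... | yes F≤B = suc L , F≤B , B<F
    ... | no F≰B  = descend L (ℕₚ.≰⇒> F≰B)

  fib≤cube : ∀ {n K L k} → 1 ℕ.≤ n → k ℕ.+ 4 ℕ.≤ L ℕ.+ K → fib (suc K) ℕ.≤ n →
             fib L ℕ.≤ n ℕ.* n → n ℕ.* n ℕ.< fib (suc L) → fib (2 ℕ.+ k) ℕ.≤ n ^ 3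
  fib≤cube {n} {K} {zero}        1≤n _ _ _ n²<F = contradiction (ℕₚ.*-mono-≤ 1≤n 1≤n) (ℕₚ.<⇒≱ n²<F)
  fib≤cube {n} {K} {suc zero}    1≤n _ _ _ n²<F = contradiction (ℕₚ.*-mono-≤ 1≤n 1≤n) (ℕₚ.<⇒≱ n²<F)
  fib≤cube {n} {K} {suc (suc m)} {k} _ k+4≤L+K F≤n F≤n² _ = begin
    fib (2 ℕ.+ k)               ≤⟨ fib-mono 2+k≤K+m ⟩
    fib (K ℕ.+ m)               ≤⟨ fib≤fib*fib K m ⟩
    fib (suc K) ℕ.* fib (suc m) ≤⟨ ℕₚ.*-mono-≤ F≤n (ℕₚ.≤-trans (fib[n]≤fib[1+n] (suc m)) F≤n²) ⟩
    n ℕ.* (n ℕ.* n)             ≡⟨ cong (λ x → n ℕ.* (n ℕ.* x)) (ℕₚ.*-identityʳ n) ⟨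
    n ^ 3                       ∎
    where
    open ℕₚ.≤-Reasoning
    2+k≤K+m : 2 ℕ.+ k ℕ.≤ K ℕ.+ m
    2+k≤K+m = ℕₚ.+-cancelˡ-≤ 2 _ _ (begin
      2 ℕ.+ (2 ℕ.+ k)      ≡⟨ regroup₁ k ⟩
      k ℕ.+ 4              ≤⟨ k+4≤L+K ⟩
      suc (suc m) ℕ.+ K    ≡⟨ regroup₂ m K ⟩
      2 ℕ.+ (K ℕ.+ m)      ∎)
      where
      regroup₁ : ∀ k → 2 ℕ.+ (2 ℕ.+ k) ≡ k ℕ.+ 4
      regroup₁ = ℕ-Solver.solve-∀
      regroup₂ : ∀ m K → suc (suc m) ℕ.+ K ≡ 2 ℕ.+ (K ℕ.+ m)
      regroup₂ = ℕ-Solver.solve-∀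

  leftmost-from-chips : ∀ {T ℓ i} → T ≗ tally ℓ → i ∈ ℓ → (∀ {q} → q ∈ ℓ → i ≤ q) → IsLeftmost T i
  leftmost-from-chips {T} {ℓ} {i} T≗ i∈ i≤ = subst (0 ℕ.<_) (sym (T≗ i)) (∈⇒count-pos i∈) , absent
    where
    absent : ∀ j → j ℤ.< i → T j ≡ 0
    absent j j<i with count j ℓ in count≡
    ... | zero  = trans (T≗ j) count≡
    ... | suc _ = contradiction (i≤ (count-pos⇒∈ ℓ (subst (0 ℕ.<_) (sym count≡) (s≤s z≤n)))) (ℤₚ.<⇒≱ j<i)

  ceiling : ∀ {n ℓ i t} → Balanced n ℓ → 1 ℕ.≤ n → (∀ {q} → q ∈ ℓ → i ≤ q) →
              t ∈ ℓ → (∀ {q} → q ∈ ℓ → q ≤ t) → ∃[ K ] Below K ℓ × fib (suc K) ℕ.≤ n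
  ceiling {t = + k}      bal _   i≤ t∈ ≤t = k , ≤t , top-bound bal i≤ t∈
  ceiling {t = -[1+ _ ]} bal 1≤n i≤ t∈ ≤t = 0 , (λ q∈ → ℤₚ.≤-trans (≤t q∈) -≤+) , 1≤n

  offset≡ : ∀ {n K R k} i → + R ≡ + K - i → + 2 * + n - + 8 - (- i) ≡ + k →
            k ℕ.+ 8 ℕ.+ R ≡ 2 ℕ.* n ℕ.+ K
  offset≡ {n} {K} {R} {k} i R≡ k≡ = ℤₚ.+-injective (begin
    + k + + 8 + + R                               ≡⟨ cong₂ (λ a b → a + + 8 + b) (sym k≡) R≡ ⟩
    (+ 2 * + n - + 8 - (- i)) + + 8 + (+ K - i)   ≡⟨ cancel (+ 2 * + n) i (+ K) ⟩
    + 2 * + n + + K                               ≡⟨ cong (_+ + K) (ℤₚ.pos-* 2 n) ⟨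
    + (2 ℕ.* n ℕ.+ K)                             ∎)
    where
    open ≡-Reasoning
    cancel : ∀ m i K → (m - + 8 - (- i)) + + 8 + (K - i) ≡ m + K
    cancel = solve-∀

  offset≤ : ∀ {n K L R k} → k ℕ.+ 8 ℕ.+ R ≡ 2 ℕ.* n ℕ.+ K → 2 ℕ.* n ℕ.≤ R ℕ.+ suc L ℕ.+ 3 →
            k ℕ.+ 4 ℕ.≤ L ℕ.+ K
  offset≤ {n} {K} {L} {R} {k} k+8+R≡ 2n≤ = ℕₚ.+-cancelʳ-≤ (4 ℕ.+ R) _ _ (begin
    k ℕ.+ 4 ℕ.+ (4 ℕ.+ R)         ≡⟨ regroup₁ k R ⟩
    k ℕ.+ 8 ℕ.+ R                 ≡⟨ k+8+R≡ ⟩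
    2 ℕ.* n ℕ.+ K                 ≤⟨ ℕₚ.+-monoˡ-≤ K 2n≤ ⟩
    R ℕ.+ suc L ℕ.+ 3 ℕ.+ K       ≡⟨ regroup₂ R L K ⟩
    L ℕ.+ K ℕ.+ (4 ℕ.+ R)         ∎)
    where
    open ℕₚ.≤-Reasoning
    regroup₁ : ∀ k R → k ℕ.+ 4 ℕ.+ (4 ℕ.+ R) ≡ k ℕ.+ 8 ℕ.+ R
    regroup₁ = ℕ-Solver.solve-∀
    regroup₂ : ∀ R L K → R ℕ.+ suc L ℕ.+ 3 ℕ.+ K ≡ L ℕ.+ K ℕ.+ (4 ℕ.+ R)
    regroup₂ = ℕ-Solver.solve-∀

  leftmost-bound : ∀ {n T ℓ} → 1 ℕ.≤ n → T ≗ tally ℓ → Balanced n ℓ → length ℓ ≡ n →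
                   (∀ q → count q ℓ ℕ.≤ 1) →
                   Σ ℤ λ i → IsLeftmost T i × ≤LogPhi (+ 2 * + n - + 8 - (- i)) 3 n
  leftmost-bound {ℓ = []} 1≤n _ _ len _ = contradiction (subst (1 ℕ.≤_) (sym len) 1≤n) λ ()
  leftmost-bound {n} {ℓ = x ∷ xs} 1≤n T≗ bal len distinct
    with lowest x xs | highest x xs | fib-bracket (n ℕ.* n)
  ... | i , i∈ , i≤ | t , t∈ , ≤t | L , F≤n² , n²<F with ceiling bal 1≤n i≤ t∈ ≤t
  ... | K , below , F≤n = i , leftmost-from-chips T≗ i∈ i≤ , ≤LogPhi-fib _ 3 n λ k k≡ →
    fib≤cube {n} {K} {L} 1≤n (offset≤ {n} (offset≡ {n} i (+depth (below i∈)) k≡) spread′) F≤n F≤n² n²<F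
    where
    spread′ : 2 ℕ.* n ℕ.≤ depth K i ℕ.+ suc L ℕ.+ 3
    spread′ = spread bal len distinct below (ℕₚ.≤-trans (fib[n]≤fib[1+n] K) F≤n) i∈ i≤ n²<F

  lower-bound : ∀ {n} → 1 ℕ.≤ n →
                Σ State λ T → Reachable (start n) T × Σ ℤ λ i → IsLeftmost T i ×
                  ≤LogPhi (+ 2 * + n - + 8 - (- i)) 3 n
  lower-bound {n} 1≤n = final , moves , leftmost-bound {ℓ = chips} 1≤n tallies balanced size distinct
    where
    open DistinctReach (settle (n ℕ.* (2 ℕ.+ 3 ℕ.* n)) (replicate n 0ℤ) (start≗tally n) (balanced-start n)
                               (length-replicate n) (excess-start n n))

open import Data.Nat as ℕ using (ℕ)
open import Data.Integer as ℤ using (ℤ; +_; -_; _-_; _+_; _*_)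
open import Data.Product using (Σ; _×_; _,_)
import Data.Nat.Properties as ℕₚ

mainTheorem2 : (n : ℕ) → 20 ℕ.≤ n →
  -- lower bound: some reachable T has -m(T) ≥ 2n - 3 log_φ n - 8,
  -- i.e. 2n - 8 - (-m(T)) ≤ 3 log_φ n
  (Σ State λ T → Reachable (start n) T × Σ ℤ λ i → IsLeftmost T i ×
     ≤LogPhi (+ 2 * + n - + 8 - (- i)) 3 n)
  ×
  -- upper bound: every reachable T has -m(T) ≤ 2n + log_φ n + 2,
  -- i.e. (-m(T)) - 2n - 2 ≤ 1 · log_φ n
  ((T : State) → Reachable (start n) T → (i : ℤ) → IsLeftmost T i →
     ≤LogPhi (- i - + 2 * + n - + 2) 1 n)
mainTheorem2 n 20≤n =
  LowerBound.lower-bound (ℕₚ.≤-trans (ℕ.s≤s ℕ.z≤n) 20≤n) ,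
  λ T moves i leftmost → UpperBound.upper-bound moves leftmost
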